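{- Let $G$ be a finite group and $p$ a prime divisor of $\#G$ such that a $p$-Sylow subgroup $S_p$ of $G$ is normal and abelian. Let $H$ be a subgroup of $G$ and $\mathcal{D}$ a set of subgroups of $G$ containing all cyclic subgroups of $G$. Assume $\mathrm{III}^2_{\mathcal{D}}(G,J_{G/S_pH})=\mathrm{III}^2_\omega(G,J_{G/S_pH})$. Then there is an isomorphism $$\mathrm{III}^2_{\mathcal{D}}(G,J_{G/H})^{(p)}\cong\mathrm{III}^2_{\mathcal{D}}(G,J_{G/S_pH}).$$
   Context: For a subgroup $H$ of a finite group $G$, $J_{G/H}$ is the $G$-lattice $\mathbb{Z}[G/H]/\mathbb{Z}\cdot\sum_{gH\in G/H}gH$. For a set $\mathcal{D}$ of subgroups of $G$ and a $G$-module $M$, $\mathrm{III}^2_{\mathcal{D}}(G,M):=\ker\big(H^2(G,M)\to\bigoplus_{D\in\mathcal{D}}H^2(D,M)\big)$ (product of restriction maps); $\mathrm{III}^2_\omega(G,M)$ denotes this group when $\mathcal{D}$ is the set of all cyclic subgroups of $G$. For a finite abelian group $A$, $A^{(p)}:=\{a\in A: na=0 \text{ for some } n\in\mathbb{Z}\setminus p\mathbb{Z}\}$. -}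

module Defs where

open import Data.Nat using (ℕ; zero; suc; _*_; _^_)
open import Data.Nat.Divisibility using (_∣_)
open import Data.Integer as ℤ using (ℤ; 0ℤ)
open import Data.Fin using (Fin; _≟_)
open import Data.Bool using (Bool; true; false; if_then_else_; _∧_; T)
open import Data.List using (allFin)
open import Data.Bool.ListAction using (any)
open import Data.Product using (Σ; ∃; _×_; _,_)
open import Relation.Nullary using (¬_)
open import Relation.Nullary.Decidable using (⌊_⌋)
open import Relation.Binary.PropositionalEquality using (_≡_; refl; sym; trans; cong; cong₂)

record FinGroup : Set where
  infixl 7 _·_
  field
    n     : ℕ
    _·_   : Fin n → Fin n → Fin n
    e     : Fin n
    _⁻¹   : Fin n → Fin n
    assoc : ∀ x y z → (x · y) · z ≡ x · (y · z)
    idˡ   : ∀ x → e · x ≡ x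
    idʳ   : ∀ x → x · e ≡ x
    invˡ  : ∀ x → (x ⁻¹) · x ≡ e
    invʳ  : ∀ x → x · (x ⁻¹) ≡ e

module _ (G : FinGroup) where
  open FinGroup G

  Subset : Set
  Subset = Fin n → Bool

  _∈_ : Fin n → Subset → Set
  x ∈ S = T (S x)

  card : ∀ {m} → (Fin m → Bool) → ℕ
  card {zero}  S = 0
  card {suc m} S = (if S Fin.zero then 1 else 0) Data.Nat.+ card (λ i → S (Fin.suc i))

  IsSubgroup : Subset → Set
  IsSubgroup S = (e ∈ S) × (∀ x y → x ∈ S → y ∈ S → (x · y) ∈ S) × (∀ x → x ∈ S → (x ⁻¹) ∈ S)

  IsNormal : Subset → Set
  IsNormal S = ∀ g x → x ∈ S → ((g · x) · (g ⁻¹)) ∈ S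

  IsAbelianSub : Subset → Set
  IsAbelianSub S = ∀ x y → x ∈ S → y ∈ S → x · y ≡ y · x

  IsSylow : ℕ → Subset → Set
  IsSylow p S = IsSubgroup S × Σ ℕ λ a → Σ ℕ λ m → (card S ≡ p ^ a) × (n ≡ p ^ a * m) × ¬ (p ∣ m)

  prodSub : Subset → Subset → Subset
  prodSub S H x = any (λ s → any (λ h → S s ∧ H h ∧ ⌊ (s · h) ≟ x ⌋) (allFin n)) (allFin n)

  pow : Fin n → ℕ → Fin n
  pow g zero    = e
  pow g (suc k) = g · pow g k

  IsCyclicSubgroup : Subset → Set
  IsCyclicSubgroup C = Σ (Fin n) λ g → ∀ x → ((x ∈ C → Σ ℕ λ k → pow g k ≡ x) × ((Σ ℕ λ k → pow g k ≡ x) → x ∈ C))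

-- G-modules (operations only; equality is a setoid relation _≈_)

record GMod (G : FinGroup) : Set₁ where
  open FinGroup G
  field
    Carrier : Set
    _≈_     : Carrier → Carrier → Set
    _+_     : Carrier → Carrier → Carrier
    -_      : Carrier → Carrier
    𝟘       : Carrier
    act     : Fin n → Carrier → Carrier

-- The lattice J_{G/K} = ℤ[G/K] / ℤ·(Σ_{gK} gK).
-- ℤ[G/K] is realised as the K-right-invariant functions f : G → ℤ
-- (the basis element gK is the indicator function of the coset gK),
-- with action (g·f)(x) = f(g⁻¹x); the norm element Σ gK is the constant
-- function 1, so J_{G/K} is this modulo constant functions.

module _ (G : FinGroup) where
  open FinGroup G

  RInv : Subset G → (Fin n → ℤ) → Set
  RInv K f = ∀ x k → _∈_ G k K → f (x · k) ≡ f x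

  J : Subset G → GMod G
  J K = record
    { Carrier = Σ (Fin n → ℤ) (RInv K)
    ; _≈_ = λ { (f , _) (f' , _) → Σ ℤ λ c → ∀ x → f x ≡ f' x ℤ.+ c }
    ; _+_ = λ { (f , pf) (f' , pf') → (λ x → f x ℤ.+ f' x) , (λ x k kK → cong₂ ℤ._+_ (pf x k kK) (pf' x k kK)) }
    ; -_ = λ { (f , pf) → (λ x → ℤ.- f x) , (λ x k kK → cong ℤ.-_ (pf x k kK)) }
    ; 𝟘 = (λ _ → 0ℤ) , (λ _ _ _ → refl)
    ; act = λ { g (f , pf) → (λ x → f ((g ⁻¹) · x)) , (λ x k kK → trans (cong f (sym (assoc (g ⁻¹) x k))) (pf ((g ⁻¹) · x) k kK)) }
    }

-- Group cohomology H² via inhomogeneous (standard) cochains.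

module Coh (G : FinGroup) (M : GMod G) where
  open FinGroup G
  open GMod M

  _-_ : Carrier → Carrier → Carrier
  a - b = a + (- b)

  C¹ : Set
  C¹ = Fin n → Carrier

  C² : Set
  C² = Fin n → Fin n → Carrier

  δ¹ : C¹ → C²
  δ¹ b g h = ((act g (b h)) - b (g · h)) + b g

  δ² : C² → Fin n → Fin n → Fin n → Carrier
  δ² c g h k = (((act g (c h k)) - c (g · h) k) + c g (h · k)) - c g h

  IsCocycle : C² → Set
  IsCocycle c = ∀ g h k → δ² c g h k ≈ 𝟘

  _⊕_ : C² → C² → C²
  (c ⊕ c') g h = c g h + c' g h

  _⊛_ : ℕ → C² → C²
  (zero ⊛ c) g h = 𝟘
  (suc m ⊛ c) g h = c g h + (m ⊛ c) g h

  Cohomologous : C² → C² → Set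
  Cohomologous c c' = Σ C¹ λ b → ∀ g h → c g h ≈ (c' g h + δ¹ b g h)

  IsTrivialClass : C² → Set
  IsTrivialClass c = Σ C¹ λ b → ∀ g h → c g h ≈ δ¹ b g h

  ResVanishes : Subset G → C² → Set
  ResVanishes D c = Σ C¹ λ b → ∀ g h → _∈_ G g D → _∈_ G h D → c g h ≈ δ¹ b g h

  Ш² : (Subset G → Set) → C² → Set
  Ш² 𝒟 c = IsCocycle c × (∀ D → 𝒟 D → ResVanishes D c)

  Ш²ω : C² → Set
  Ш²ω = Ш² (IsCyclicSubgroup G)

  -- the class of c lies in the prime-to-p part A^(p): killed by some m with p ∤ m
  PrimeToP : ℕ → C² → Set
  PrimeToP p c = Σ ℕ λ m → ¬ (p ∣ m) × IsTrivialClass (m ⊛ c)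

-- Isomorphism between subgroups A₁ ⊆ H²(G,M₁), A₂ ⊆ H²(G,M₂), where
-- Aᵢ is given by a predicate on cocycles closed under cohomology.

module _ (G : FinGroup) (M₁ M₂ : GMod G) where
  private
    module C₁ = Coh G M₁
    module C₂ = Coh G M₂

  ClassIso : (C₁.C² → Set) → (C₂.C² → Set) → Set
  ClassIso A₁ A₂ =
    Σ (C₁.C² → C₂.C²) λ f →
      (∀ c → A₁ c → A₂ (f c))
    × (∀ c c' → A₁ c → A₁ c' → C₁.Cohomologous c c' → C₂.Cohomologous (f c) (f c'))
    × (∀ c c' → A₁ c → A₁ c' → C₂.Cohomologous (f (c C₁.⊕ c')) (f c C₂.⊕ f c'))
    × (∀ c c' → A₁ c → A₁ c' → C₂.Cohomologous (f c) (f c') → C₁.Cohomologous c c')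
    × (∀ d → A₂ d → Σ C₁.C² λ c → A₁ c × C₂.Cohomologous (f c) d)

-- Write N = Sp, K = N H, q = #N = p^a and m = [G : N], prime to p. The trace
-- J_{G/H} → J_{G/K}, a ↦ Σ_{k ∈ N} a(· k), followed by the inclusion J_{G/K} ⊆ J_{G/H}
-- is q on 2-cocycles up to coboundaries, and the other composite is q on J_{G/K}; as q is a
-- power of p, the trace is injective on the prime-to-p part of Ш²_𝒟(G, J_{G/H}).
-- Conversely N acts trivially on J_{G/K} and a class of Ш²_𝒟 vanishes on each cyclic
-- ⟨w⟩ ⊆ N; as Hom(⟨w⟩, ℤ) = 0 this pins down the N-sums of the cocycle, and running the
-- usual proof that #G kills H² over a transversal of N shows that m kills Ш²_𝒟(G, J_{G/K}).
-- So every class there is prime-to-p, and u d with u q + v m = 1 is a preimage of d.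

module Submission where

open import Level using (0ℓ)
open import Algebra.Bundles using (Group)
import Algebra.Properties.Group as GroupProperties
open import Data.Nat as ℕ using (ℕ; zero; suc)
import Data.Nat.Properties as ℕP
open import Data.Nat.DivMod using (_%_; _/_; m≡m%n+[m/n]*n; m%n<n)
open import Data.Nat.Divisibility using (_∣_)
open import Data.Nat.Primality using (Prime; prime⇒irreducible; prime⇒nonZero; euclidsLemma)
open import Data.Nat.Coprimality using (Coprime; coprime-Bézout)
open import Data.Nat.GCD using (module Bézout)
open import Data.Integer using (ℤ; +_; 0ℤ; -1ℤ; _+_; _*_; -_; _-_)
import Data.Integer.Properties as ℤP
open import Data.Integer.Tactic.RingSolver using (solve-∀)
open import Algebra.Properties.Semiring.Sum ℤP.+-*-semiring
  using (sum; sum-cong-≗; ∑-distrib-+; ∑-comm; sum-permute; sum-replicate-zero; *-distribˡ-sum)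
open import Data.Fin using (Fin; zero; suc; _≟_; toℕ; fromℕ<)
import Data.Fin.Properties as FinP
open import Data.Fin.Permutation using (permutation)
open import Data.Bool using (Bool; true; false; if_then_else_; T; _∧_)
open import Data.Bool.Properties using (T-∧)
open import Data.Bool.ListAction using (any)
open import Data.List using (allFin)
open import Data.List.Membership.Propositional using (lose)
open import Data.List.Membership.Propositional.Properties using (∈-allFin)
open import Data.List.Relation.Unary.Any using (satisfied)
open import Data.List.Relation.Unary.Any.Properties using (any⁺; any⁻)
open import Data.Maybe as Maybe using (Maybe; just; nothing; fromMaybe)
open import Data.Maybe.Properties using (just-injective)
open import Data.Unit using (tt)
open import Data.Empty using (⊥-elim)
open import Data.Product using (Σ; _×_; _,_; proj₁; proj₂)
open import Data.Sum using (inj₁; inj₂; [_,_]′)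
open import Function using (Equivalence)
open import Relation.Nullary using (¬_; yes; no)
open import Relation.Nullary.Decidable using (⌊_⌋; toWitness; fromWitness)
open import Relation.Binary.PropositionalEquality hiding (J)
open import Defs

T-injective : ∀ {a b : Bool} → (T a → T b) → (T b → T a) → a ≡ b
T-injective {false} {false} _ _ = refl
T-injective {false} {true}  _ g = ⊥-elim (g tt)
T-injective {true}  {false} f _ = ⊥-elim (f tt)
T-injective {true}  {true}  _ _ = refl

sum-reindex : ∀ {k} (σ τ : Fin k → Fin k) → (∀ x → τ (σ x) ≡ x) → (∀ y → σ (τ y) ≡ y)
  → ∀ f → sum (λ x → f (σ x)) ≡ sum f
sum-reindex σ τ τσ στ f = sym (sum-permute f (permutation σ τ στ τσ))

sum-δ : ∀ {k} (j : Fin k) f → sum (λ i → if ⌊ i ≟ j ⌋ then f i else 0ℤ) ≡ f j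
sum-δ {suc k} zero f = trans (cong (λ w → f zero + w) (sum-replicate-zero k)) (ℤP.+-identityʳ _)
sum-δ {suc k} (suc j) f = trans (ℤP.+-identityˡ _) (trans (sum-cong-≗ off-diagonal) (sum-δ j (λ i → f (suc i))))
  where
  off-diagonal : ∀ i → (if ⌊ suc i ≟ suc j ⌋ then f (suc i) else 0ℤ) ≡ (if ⌊ i ≟ j ⌋ then f (suc i) else 0ℤ)
  off-diagonal i with i ≟ j
  ... | yes _ = refl
  ... | no  _ = refl

if-sum : ∀ {k} b (f : Fin k → ℤ) → (if b then sum f else 0ℤ) ≡ sum (λ i → if b then f i else 0ℤ)
if-sum true  f = refl
if-sum {k} false f = sym (sum-replicate-zero k)

if-∧ : ∀ a b {x : ℤ} → (if a then (if b then x else 0ℤ) else 0ℤ) ≡ (if a ∧ b then x else 0ℤ)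
if-∧ true  b = refl
if-∧ false b = refl

sumOver : ∀ {k} → (Fin k → Bool) → (Fin k → ℤ) → ℤ
sumOver P f = sum (λ i → if P i then f i else 0ℤ)

module _ {k : ℕ} (P : Fin k → Bool) where

  sumOver-cong : ∀ {f g} → (∀ i → T (P i) → f i ≡ g i) → sumOver P f ≡ sumOver P g
  sumOver-cong h = sum-cong-≗ (λ i → on (P i) (h i))
    where
    on : ∀ b {x y} → (T b → x ≡ y) → (if b then x else 0ℤ) ≡ (if b then y else 0ℤ)
    on false _ = refl
    on true  h = h tt

  sumOver-+ : ∀ f g → sumOver P (λ i → f i + g i) ≡ sumOver P f + sumOver P g
  sumOver-+ f g = trans (sum-cong-≗ (λ i → on (P i))) (∑-distrib-+ (λ i → if P i then f i else 0ℤ) (λ i → if P i then g i else 0ℤ))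
    where
    on : ∀ b {x y} → (if b then x + y else 0ℤ) ≡ (if b then x else 0ℤ) + (if b then y else 0ℤ)
    on false = refl
    on true  = refl

  sumOver-*ˡ : ∀ z f → sumOver P (λ i → z * f i) ≡ z * sumOver P f
  sumOver-*ˡ z f = trans (sum-cong-≗ (λ i → on (P i))) (sym (*-distribˡ-sum z (λ i → if P i then f i else 0ℤ)))
    where
    on : ∀ b {x} → (if b then z * x else 0ℤ) ≡ z * (if b then x else 0ℤ)
    on false = sym (ℤP.*-zeroʳ z)
    on true  = refl

  sumOver-neg : ∀ f → sumOver P (λ i → - f i) ≡ - sumOver P f
  sumOver-neg f = begin
    sumOver P (λ i → - f i)     ≡⟨ sumOver-cong (λ i _ → sym (ℤP.-1*i≡-i (f i))) ⟩
    sumOver P (λ i → -1ℤ * f i) ≡⟨ sumOver-*ˡ -1ℤ f ⟩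
    -1ℤ * sumOver P f           ≡⟨ ℤP.-1*i≡-i _ ⟩
    - sumOver P f               ∎
    where open ≡-Reasoning

  sumOver-- : ∀ f g → sumOver P (λ i → f i - g i) ≡ sumOver P f - sumOver P g
  sumOver-- f g = trans (sumOver-+ f _) (cong (λ w → sumOver P f + w) (sumOver-neg g))

  sumOver-[f-g+h] : ∀ f g h → sumOver P (λ i → f i - g i + h i) ≡ sumOver P f - sumOver P g + sumOver P h
  sumOver-[f-g+h] f g h = trans (sumOver-+ _ h) (cong (_+ sumOver P h) (sumOver-- f g))

  sumOver-[f-g+h-j] : ∀ f g h j →
    sumOver P (λ i → f i - g i + h i - j i) ≡ sumOver P f - sumOver P g + sumOver P h - sumOver P j
  sumOver-[f-g+h-j] f g h j = trans (sumOver-- _ j) (cong (_- sumOver P j) (sumOver-[f-g+h] f g h))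

  sumOver-const : (G : FinGroup) → ∀ c → sumOver P (λ _ → c) ≡ + card G P * c
  sumOver-const G c = go P
    where
    go : ∀ {k} (S : Fin k → Bool) → sum (λ i → if S i then c else 0ℤ) ≡ + card G S * c
    go {zero}  S = sym (ℤP.*-zeroˡ c)
    go {suc k} S with S zero
    ... | false = trans (ℤP.+-identityˡ _) (go (λ i → S (suc i)))
    ... | true  = trans (cong (λ w → c + w) (go (λ i → S (suc i)))) (add-one (card G (λ i → S (suc i))))
      where
      add-one : ∀ m → c + + m * c ≡ + suc m * c
      add-one m = trans (cong (_+ + m * c) (sym (ℤP.*-identityˡ c))) (sym (ℤP.*-distribʳ-+ c (+ 1) (+ m)))

  sumOver-zero : ∀ f → (∀ i → f i ≡ 0ℤ) → sumOver P f ≡ 0ℤ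
  sumOver-zero f h = trans (sum-cong-≗ (λ i → on (P i) (h i))) (sum-replicate-zero k)
    where
    on : ∀ b {x} → x ≡ 0ℤ → (if b then x else 0ℤ) ≡ 0ℤ
    on false _ = refl
    on true  h = h

  sumOver-reindex : ∀ (σ τ : Fin k → Fin k) → (∀ x → τ (σ x) ≡ x) → (∀ y → σ (τ y) ≡ y)
    → (∀ x → P (σ x) ≡ P x) → ∀ f → sumOver P (λ x → f (σ x)) ≡ sumOver P f
  sumOver-reindex σ τ τσ στ Pσ f = trans
    (sum-cong-≗ (λ x → cong (λ b → if b then f (σ x) else 0ℤ) (sym (Pσ x))))
    (sum-reindex σ τ τσ στ (λ i → if P i then f i else 0ℤ))

find : ∀ {k} → (Fin k → Bool) → Maybe (Fin k)
find {zero}  P = nothing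
find {suc k} P = if P zero then just zero else Maybe.map suc (find (λ i → P (suc i)))

find-cong : ∀ {k} {P Q : Fin k → Bool} → (∀ i → P i ≡ Q i) → find P ≡ find Q
find-cong {zero}  h = refl
find-cong {suc k} h = cong₂ (λ b m → if b then just zero else Maybe.map suc m) (h zero) (find-cong (λ i → h (suc i)))

find-sound : ∀ {k} (P : Fin k → Bool) {y} → find P ≡ just y → T (P y)
find-sound {suc k} P eq with P zero in P0 | find (λ i → P (suc i)) in rest
find-sound {suc k} P refl | true  | _      = subst T (sym P0) tt
find-sound {suc k} P refl | false | just y = find-sound (λ i → P (suc i)) rest

find-complete : ∀ {k} (P : Fin k → Bool) z → T (P z) → Σ (Fin k) λ y → find P ≡ just y
find-complete {suc k} P z Pz with P zero in P0
... | true = zero , refl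
find-complete {suc k} P zero    Pz | false = ⊥-elim (subst T P0 Pz)
find-complete {suc k} P (suc z) Pz | false with find-complete (λ i → P (suc i)) z Pz
... | y , eq = suc y , cong (Maybe.map suc) eq

BézoutIdentity : ℕ → ℕ → Set
BézoutIdentity a b = Σ ℤ λ u → Σ ℤ λ v → u * + a + v * + b ≡ + 1

bézout-prime : ∀ {p b} → Prime p → ¬ (p ∣ b) → BézoutIdentity p b
bézout-prime {p} {b} p-prime p∤b = fromℕ (coprime-Bézout coprime)
  where
  coprime : Coprime p b
  coprime (i∣p , i∣b) with prime⇒irreducible p-prime i∣p
  ... | inj₁ i≡1 = i≡1
  ... | inj₂ refl = ⊥-elim (p∤b i∣b)
  cast : ∀ x y z w → 1 ℕ.+ x ℕ.* y ≡ z ℕ.* w → + 1 + + x * + y ≡ + z * + w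
  cast x y z w eq = begin
    + 1 + + x * + y     ≡⟨ cong (λ t → + 1 + t) (ℤP.pos-* x y) ⟨
    + (1 ℕ.+ x ℕ.* y)   ≡⟨ cong +_ eq ⟩
    + (z ℕ.* w)         ≡⟨ ℤP.pos-* z w ⟩
    + z * + w           ∎
    where open ≡-Reasoning
  rearrange : ∀ s t → + 1 + s ≡ t → t + - s ≡ + 1
  rearrange s _ refl = trans (ℤP.+-assoc (+ 1) s (- s)) (cong (λ w → + 1 + w) (ℤP.+-inverseʳ s))
  fromℕ : Bézout.Identity 1 p b → BézoutIdentity p b
  fromℕ (Bézout.+- x y eq) = + x , - + y ,
    trans (cong (λ t → + x * + p + t) (sym (ℤP.neg-distribˡ-* (+ y) (+ b)))) (rearrange _ _ (cast y b x p eq))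
  fromℕ (Bézout.-+ x y eq) = - + x , + y ,
    trans (cong (_+ + y * + b) (sym (ℤP.neg-distribˡ-* (+ x) (+ p))))
      (trans (ℤP.+-comm (- (+ x * + p)) _) (rearrange _ _ (cast x p y b eq)))

-- (u a)(u' a') = (1 - v b)(1 - v' b) ≡ 1 mod b.
bézout-* : ∀ {a a' b} → BézoutIdentity a b → BézoutIdentity a' b → BézoutIdentity (a ℕ.* a') b
bézout-* {a} {a'} {b} (u , v , eq) (u' , v' , eq') = u * u' , v + v' - v * v' * + b ,
  trans (cong (λ t → u * u' * t + (v + v' - v * v' * + b) * + b) (ℤP.pos-* a a'))
    (trans (expand u v u' v' (+ a) (+ a') (+ b))
      (cong₂ (λ s t → s * (u' * + a') + t * (+ 1 - v * + b) + + 1) (ℤP.i≡j⇒i-j≡0 eq) (ℤP.i≡j⇒i-j≡0 eq')))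
  where
  expand : ∀ u v u' v' A A' B → u * u' * (A * A') + (v + v' - v * v' * B) * B
    ≡ (u * A + v * B - + 1) * (u' * A') + (u' * A' + v' * B - + 1) * (+ 1 - v * B) + + 1
  expand = solve-∀

bézout-^ : ∀ {p b} → Prime p → ¬ (p ∣ b) → ∀ a → BézoutIdentity (p ℕ.^ a) b
bézout-^ p-prime p∤b zero    = + 1 , 0ℤ , refl
bézout-^ p-prime p∤b (suc a) = bézout-* (bézout-prime p-prime p∤b) (bézout-^ p-prime p∤b a)

module GroupFacts (G : FinGroup) where
  open FinGroup G public

  group : Group 0ℓ 0ℓ
  group = record
    { Carrier = Fin n ; _≈_ = _≡_ ; _∙_ = _·_ ; ε = e ; _⁻¹ = _⁻¹
    ; isGroup = record
      { isMonoid = record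
        { isSemigroup = record { isMagma = record { isEquivalence = isEquivalence ; ∙-cong = cong₂ _·_ } ; assoc = assoc }
        ; identity = idˡ , idʳ }
      ; inverse = invˡ , invʳ
      ; ⁻¹-cong = cong _⁻¹ } }

  open GroupProperties group public
    using (⁻¹-involutive; ⁻¹-anti-homo-∙; inverseʳ-unique; ∙-cancelˡ)
    renaming ( \\-leftDividesʳ to x⁻¹[xy]≡y ; \\-leftDividesˡ to x[x⁻¹y]≡y ; //-rightDividesˡ to [yx⁻¹]x≡y )

  conj : Fin n → Fin n → Fin n
  conj g k = (g · k) · g ⁻¹

  conj⁻¹ : ∀ g k → conj (g ⁻¹) (conj g k) ≡ k
  conj⁻¹ g k = begin
    (g ⁻¹ · ((g · k) · g ⁻¹)) · g ⁻¹ ⁻¹ ≡⟨ cong (λ z → (g ⁻¹ · ((g · k) · g ⁻¹)) · z) (⁻¹-involutive g) ⟩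
    (g ⁻¹ · ((g · k) · g ⁻¹)) · g       ≡⟨ assoc _ _ _ ⟩
    g ⁻¹ · (((g · k) · g ⁻¹) · g)       ≡⟨ cong (g ⁻¹ ·_) ([yx⁻¹]x≡y g (g · k)) ⟩
    g ⁻¹ · (g · k)                      ≡⟨ x⁻¹[xy]≡y g k ⟩
    k                                   ∎
    where open ≡-Reasoning

  x·conj[x⁻¹,m]≡m·x : ∀ x m → x · conj (x ⁻¹) m ≡ m · x
  x·conj[x⁻¹,m]≡m·x x m = begin
    x · ((x ⁻¹ · m) · x ⁻¹ ⁻¹) ≡⟨ cong (λ z → x · ((x ⁻¹ · m) · z)) (⁻¹-involutive x) ⟩
    x · ((x ⁻¹ · m) · x)       ≡⟨ sym (assoc _ _ _) ⟩
    (x · (x ⁻¹ · m)) · x       ≡⟨ cong (_· x) (x[x⁻¹y]≡y x m) ⟩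
    m · x                      ∎
    where open ≡-Reasoning

  module Subgroup (S : Subset G) (S-sub : IsSubgroup G S) where

    e∈ : T (S e)
    e∈ = proj₁ S-sub

    ·∈ : ∀ x y → T (S x) → T (S y) → T (S (x · y))
    ·∈ = proj₁ (proj₂ S-sub)

    ⁻¹∈ : ∀ x → T (S x) → T (S (x ⁻¹))
    ⁻¹∈ = proj₂ (proj₂ S-sub)

    ⁻¹∈⁻ : ∀ x → T (S (x ⁻¹)) → T (S x)
    ⁻¹∈⁻ x x⁻¹∈S = subst (λ z → T (S z)) (⁻¹-involutive x) (⁻¹∈ (x ⁻¹) x⁻¹∈S)

    ·ˡ-invariant : ∀ s k → T (S s) → S (s · k) ≡ S k
    ·ˡ-invariant s k s∈S = T-injective
      (λ sk∈S → subst (λ z → T (S z)) (x⁻¹[xy]≡y s k) (·∈ (s ⁻¹) (s · k) (⁻¹∈ s s∈S) sk∈S))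
      (·∈ s k s∈S)

    sumOver-·ˡ : ∀ s → T (S s) → ∀ F → sumOver S (λ k → F (s · k)) ≡ sumOver S F
    sumOver-·ˡ s s∈S = sumOver-reindex S (s ·_) (s ⁻¹ ·_) (x⁻¹[xy]≡y s) (x[x⁻¹y]≡y s) (λ k → ·ˡ-invariant s k s∈S)

    sumOver-⁻¹ : ∀ F → sumOver S (λ k → F (k ⁻¹)) ≡ sumOver S F
    sumOver-⁻¹ = sumOver-reindex S _⁻¹ _⁻¹ ⁻¹-involutive ⁻¹-involutive (λ k → T-injective (⁻¹∈⁻ k) (⁻¹∈ k))

  module Normal (N : Subset G) (N-normal : IsNormal G N) where

    conj-invariant : ∀ g k → N (conj g k) ≡ N k
    conj-invariant g k = T-injective
      (λ gkg⁻¹∈N → subst (λ z → T (N z)) (conj⁻¹ g k) (N-normal (g ⁻¹) _ gkg⁻¹∈N))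
      (N-normal g k)

    sumOver-conj : ∀ g F → sumOver N (λ k → F (conj g k)) ≡ sumOver N F
    sumOver-conj g = sumOver-reindex N (conj g) (conj (g ⁻¹)) (conj⁻¹ g)
      (λ k → subst (λ h → conj h (conj (g ⁻¹) k) ≡ k) (⁻¹-involutive g) (conj⁻¹ (g ⁻¹) k))
      (conj-invariant g)

  ∈-prodSub⁻ : ∀ {S H} x → T (prodSub G S H x) → Σ (Fin n) λ s → Σ (Fin n) λ h → T (S s) × T (H h) × (s · h ≡ x)
  ∈-prodSub⁻ {S} {H} x x∈SH with satisfied (any⁻ _ (allFin n) x∈SH)
  ... | s , ∃h with satisfied (any⁻ _ (allFin n) ∃h)
  ... | h , s∧h∧eq with Equivalence.to T-∧ s∧h∧eq
  ... | s∈S , h∧eq with Equivalence.to T-∧ h∧eq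
  ... | h∈H , eq = s , h , s∈S , h∈H , toWitness eq

  ∈-prodSub⁺ : ∀ {S H} s h → T (S s) → T (H h) → T (prodSub G S H (s · h))
  ∈-prodSub⁺ s h s∈S h∈H = any⁺ _ (lose (∈-allFin s) (any⁺ _ (lose (∈-allFin h)
    (Equivalence.from T-∧ (s∈S , Equivalence.from T-∧ (h∈H , fromWitness refl))))))

-- A left transversal of N: every x is rep x · offset x with rep x the first element of x N.
module Transversal (G : FinGroup) (N : Subset G) (N-sub : IsSubgroup G N) where
  open GroupFacts G
  open Subgroup N N-sub

  _~_ : Fin n → Fin n → Set
  a ~ b = T (N (a ⁻¹ · b))

  ~-refl : ∀ a → a ~ a
  ~-refl a = subst (λ z → T (N z)) (sym (invˡ a)) e∈

  ~-sym : ∀ {a b} → a ~ b → b ~ a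
  ~-sym {a} {b} a~b = subst (λ z → T (N z)) eq (⁻¹∈ _ a~b)
    where
    eq : (a ⁻¹ · b) ⁻¹ ≡ b ⁻¹ · a
    eq = trans (⁻¹-anti-homo-∙ (a ⁻¹) b) (cong (b ⁻¹ ·_) (⁻¹-involutive a))

  ~-trans : ∀ {a b c} → a ~ b → b ~ c → a ~ c
  ~-trans {a} {b} {c} a~b b~c =
    subst (λ z → T (N z)) (trans (assoc _ _ _) (cong (a ⁻¹ ·_) (x[x⁻¹y]≡y b c))) (·∈ _ _ a~b b~c)

  ~-·N : ∀ y k → T (N k) → y ~ (y · k)
  ~-·N y k k∈N = subst (λ z → T (N z)) (sym (x⁻¹[xy]≡y y k)) k∈N

  ~-·ˡ : ∀ g {a b} → a ~ b → (g · a) ~ (g · b)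
  ~-·ˡ g {a} {b} = subst (λ z → T (N z)) (sym (begin
    (g · a) ⁻¹ · (g · b)       ≡⟨ cong (_· (g · b)) (⁻¹-anti-homo-∙ g a) ⟩
    (a ⁻¹ · g ⁻¹) · (g · b)    ≡⟨ assoc _ _ _ ⟩
    a ⁻¹ · (g ⁻¹ · (g · b))    ≡⟨ cong (a ⁻¹ ·_) (x⁻¹[xy]≡y g b) ⟩
    a ⁻¹ · b                   ∎))
    where open ≡-Reasoning

  coset : Fin n → Fin n → Bool
  coset x y = N (x ⁻¹ · y)

  rep : Fin n → Fin n
  rep x = fromMaybe x (find (coset x))

  rep-~ : ∀ x → x ~ rep x
  rep-~ x with find (coset x) in eq
  ... | just y  = find-sound (coset x) eq
  ... | nothing = ~-refl x

  rep-cong : ∀ {x x'} → x ~ x' → rep x' ≡ rep x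
  rep-cong {x} {x'} x~x' with find (coset x) in eq | find (coset x') in eq'
  ... | just y  | just y' = just-injective (trans (sym eq') (trans same-coset eq))
    where
    same-coset : find (coset x') ≡ find (coset x)
    same-coset = find-cong (λ z → T-injective (~-trans x~x') (~-trans (~-sym x~x')))
  ... | nothing | _ with () ← trans (sym eq) (proj₂ (find-complete (coset x) x (~-refl x)))
  ... | just _ | nothing with () ← trans (sym eq') (proj₂ (find-complete (coset x') x' (~-refl x')))

  rep-idem : ∀ x → rep (rep x) ≡ rep x
  rep-idem x = rep-cong (rep-~ x)

  rep-·N : ∀ y k → T (N k) → rep (y · k) ≡ rep y
  rep-·N y k k∈N = rep-cong (~-·N y k k∈N)

  offset : Fin n → Fin n
  offset x = rep x ⁻¹ · x

  offset∈N : ∀ x → T (N (offset x))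
  offset∈N x = ~-sym (rep-~ x)

  rep·offset : ∀ x → rep x · offset x ≡ x
  rep·offset x = x[x⁻¹y]≡y (rep x) x

  Reps : Subset G
  Reps t = ⌊ rep t ≟ t ⌋

  rep∈Reps : ∀ y → T (Reps (rep y))
  rep∈Reps y = fromWitness (rep-idem y)

  Reps∋t~y⇒t≡rep : ∀ {t y} → T (Reps t) → t ~ y → t ≡ rep y
  Reps∋t~y⇒t≡rep {t} t∈Reps t~y = trans (sym (toWitness t∈Reps)) (sym (rep-cong t~y))

  -- Left multiplication by g permutes the cosets; shift g moves x to the coset of g x
  -- keeping its offset, so it permutes G and preserves Reps.
  shift : Fin n → Fin n → Fin n
  shift g x = rep (g · x) · offset x

  rep-shift : ∀ g x → rep (shift g x) ≡ rep (g · x)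
  rep-shift g x = trans (rep-·N (rep (g · x)) (offset x) (offset∈N x)) (rep-idem (g · x))

  offset-shift : ∀ g x → offset (shift g x) ≡ offset x
  offset-shift g x = trans (cong (λ z → z ⁻¹ · shift g x) (rep-shift g x)) (x⁻¹[xy]≡y (rep (g · x)) (offset x))

  shift⁻¹ : ∀ g x → shift (g ⁻¹) (shift g x) ≡ x
  shift⁻¹ g x = trans (cong₂ _·_ rep-back (offset-shift g x)) (rep·offset x)
    where
    x~g⁻¹rep[gx] : x ~ (g ⁻¹ · rep (g · x))
    x~g⁻¹rep[gx] = subst (λ z → z ~ (g ⁻¹ · rep (g · x))) (x⁻¹[xy]≡y g x) (~-·ˡ (g ⁻¹) (rep-~ (g · x)))
    rep-back : rep (g ⁻¹ · shift g x) ≡ rep x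
    rep-back = trans (cong rep (sym (assoc _ _ _)))
                 (trans (rep-·N _ (offset x) (offset∈N x)) (rep-cong x~g⁻¹rep[gx]))

  offset-rep : ∀ {x} → rep x ≡ x → offset x ≡ e
  offset-rep {x} eq = trans (cong (λ z → z ⁻¹ · x) eq) (invˡ x)

  shift-onReps : ∀ g {t} → T (Reps t) → shift g t ≡ rep (g · t)
  shift-onReps g {t} t∈Reps = trans (cong (rep (g · t) ·_) (offset-rep (toWitness t∈Reps))) (idʳ _)

  shift-Reps : ∀ g x → Reps (shift g x) ≡ Reps x
  shift-Reps g x = T-injective to from
    where
    to : T (Reps (shift g x)) → T (Reps x)
    to p = fromWitness (sym (trans (inverseʳ-unique (rep x ⁻¹) x offset≡e) (⁻¹-involutive (rep x))))
      where
      offset≡e : offset x ≡ e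
      offset≡e = sym (∙-cancelˡ (rep (g · x)) e (offset x)
        (trans (idʳ _) (trans (sym (rep-shift g x)) (toWitness p))))
    from : T (Reps x) → T (Reps (shift g x))
    from p = fromWitness (trans (rep-shift g x) (sym (shift-onReps g p)))

  sumOver-Reps-shift : ∀ g F → sumOver Reps (λ t → F (shift g t)) ≡ sumOver Reps F
  sumOver-Reps-shift g = sumOver-reindex Reps (shift g) (shift (g ⁻¹)) (shift⁻¹ g) shift-shift⁻¹ (shift-Reps g)
    where
    shift-shift⁻¹ : ∀ y → shift g (shift (g ⁻¹) y) ≡ y
    shift-shift⁻¹ y = subst (λ h → shift h (shift (g ⁻¹) y) ≡ y) (⁻¹-involutive g) (shift⁻¹ (g ⁻¹) y)

  sum-by-cosets : ∀ F → sumOver Reps (λ t → sumOver N (λ j → F (t · j))) ≡ sum F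
  sum-by-cosets F = begin
    sumOver Reps (λ t → sumOver N (λ j → F (t · j)))
      ≡⟨ sumOver-cong Reps (λ t _ → sum-over-coset t) ⟩
    sumOver Reps (λ t → sum (λ y → if coset t y then F y else 0ℤ))
      ≡⟨ sum-cong-≗ (λ t → if-sum (Reps t) (λ y → if coset t y then F y else 0ℤ)) ⟩
    sum (λ t → sum (λ y → if Reps t then (if coset t y then F y else 0ℤ) else 0ℤ))
      ≡⟨ ∑-comm (λ t y → if Reps t then (if coset t y then F y else 0ℤ) else 0ℤ) ⟩
    sum (λ y → sum (λ t → if Reps t then (if coset t y then F y else 0ℤ) else 0ℤ))
      ≡⟨ sum-cong-≗ (λ y → trans (sum-cong-≗ (λ t → only-rep t y)) (sum-δ (rep y) (λ _ → F y))) ⟩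
    sum F ∎
    where
    open ≡-Reasoning
    sum-over-coset : ∀ t → sumOver N (λ j → F (t · j)) ≡ sum (λ y → if coset t y then F y else 0ℤ)
    sum-over-coset t = sym (trans
      (sum-cong-≗ (λ y → cong (λ z → if coset t y then F z else 0ℤ) (sym (x[x⁻¹y]≡y t y))))
      (sum-reindex (t ⁻¹ ·_) (t ·_) (x[x⁻¹y]≡y t) (x⁻¹[xy]≡y t) (λ j → if N j then F (t · j) else 0ℤ)))
    Reps∧coset : ∀ t y → (Reps t ∧ coset t y) ≡ ⌊ t ≟ rep y ⌋
    Reps∧coset t y = T-injective
      (λ p → let (t∈Reps , t~y) = Equivalence.to T-∧ p in fromWitness (Reps∋t~y⇒t≡rep t∈Reps t~y))
      (λ p → subst (λ z → T (Reps z ∧ coset z y)) (sym (toWitness p))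
               (Equivalence.from T-∧ (rep∈Reps y , ~-sym (rep-~ y))))
    only-rep : ∀ t y → (if Reps t then (if coset t y then F y else 0ℤ) else 0ℤ) ≡ (if ⌊ t ≟ rep y ⌋ then F y else 0ℤ)
    only-rep t y = trans (if-∧ (Reps t) (coset t y)) (cong (λ b → if b then F y else 0ℤ) (Reps∧coset t y))

module Cyclic (G : FinGroup) where
  open GroupFacts G

  infixr 8 _^_
  _^_ : Fin n → ℕ → Fin n
  _^_ = pow G

  ^-+ : ∀ g a b → g ^ (a ℕ.+ b) ≡ g ^ a · g ^ b
  ^-+ g zero    b = sym (idˡ _)
  ^-+ g (suc a) b = trans (cong (g ·_) (^-+ g a b)) (sym (assoc _ _ _))

  ^-*-≡e : ∀ g {r} → g ^ r ≡ e → ∀ b → g ^ (b ℕ.* r) ≡ e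
  ^-*-≡e g gʳ≡e zero    = refl
  ^-*-≡e g {r} gʳ≡e (suc b) = trans (^-+ g r (b ℕ.* r)) (trans (cong₂ _·_ gʳ≡e (^-*-≡e g gʳ≡e b)) (idˡ e))

  -- Two of g^0, …, g^n coincide, so some 0 < r ≤ n has g^r = e.
  order : ∀ g → Σ ℕ λ r → (g ^ suc r ≡ e) × (suc r ℕ.≤ n)
  order g with FinP.pigeonhole (ℕP.n<1+n n) (λ (j : Fin (suc n)) → g ^ toℕ j)
  ... | i , j , i<j , gⁱ≡gʲ = r , gʳ⁺¹≡e , r<n
    where
    r : ℕ
    r = toℕ j ℕ.∸ suc (toℕ i)
    j≡i+r+1 : toℕ i ℕ.+ suc r ≡ toℕ j
    j≡i+r+1 = trans (ℕP.+-suc (toℕ i) r) (ℕP.m+[n∸m]≡n i<j)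
    gʳ⁺¹≡e : g ^ suc r ≡ e
    gʳ⁺¹≡e = sym (∙-cancelˡ (g ^ toℕ i) e (g ^ suc r)
      (trans (idʳ _) (trans gⁱ≡gʲ (trans (cong (g ^_) (sym j≡i+r+1)) (^-+ g (toℕ i) (suc r))))))
    r<n : suc r ℕ.≤ n
    r<n = ℕP.≤-trans (ℕP.m≤n+m (suc r) (toℕ i)) (ℕP.≤-trans (ℕP.≤-reflexive j≡i+r+1) (ℕP.≤-pred (FinP.toℕ<n j)))

  ^-% : ∀ g k → g ^ k ≡ g ^ (k % suc (proj₁ (order g)))
  ^-% g k = begin
    g ^ k                               ≡⟨ cong (g ^_) (m≡m%n+[m/n]*n k r) ⟩
    g ^ (k % r ℕ.+ k / r ℕ.* r)         ≡⟨ ^-+ g (k % r) _ ⟩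
    g ^ (k % r) · g ^ (k / r ℕ.* r)     ≡⟨ cong (g ^ (k % r) ·_) (^-*-≡e g (proj₁ (proj₂ (order g))) (k / r)) ⟩
    g ^ (k % r) · e                     ≡⟨ idʳ _ ⟩
    g ^ (k % r)                         ∎
    where
    open ≡-Reasoning
    r = suc (proj₁ (order g))

  ⟨_⟩ : Fin n → Subset G
  ⟨ g ⟩ x = any (λ (j : Fin n) → ⌊ g ^ toℕ j ≟ x ⌋) (allFin n)

  ∈⟨⟩⁻ : ∀ g x → T (⟨ g ⟩ x) → Σ ℕ λ k → g ^ k ≡ x
  ∈⟨⟩⁻ g x x∈⟨g⟩ with satisfied (any⁻ _ (allFin n) x∈⟨g⟩)
  ... | j , gʲ≡x = toℕ j , toWitness gʲ≡x

  ^∈⟨⟩ : ∀ g k → T (⟨ g ⟩ (g ^ k))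
  ^∈⟨⟩ g k = any⁺ _ (lose (∈-allFin (fromℕ< k%r<n))
    (fromWitness (trans (cong (g ^_) (FinP.toℕ-fromℕ< k%r<n)) (sym (^-% g k)))))
    where
    k%r<n : k % suc (proj₁ (order g)) ℕ.< n
    k%r<n = ℕP.<-≤-trans (m%n<n k _) (proj₂ (proj₂ (order g)))

  ⟨⟩-isCyclic : ∀ g → IsCyclicSubgroup G ⟨ g ⟩
  ⟨⟩-isCyclic g = g , λ x → ∈⟨⟩⁻ g x , λ { (k , gᵏ≡x) → subst (λ z → T (⟨ g ⟩ z)) gᵏ≡x (^∈⟨⟩ g k) }

  ⟨⟩-⊆ : ∀ {S} → IsSubgroup G S → ∀ {g} → T (S g) → ∀ x → T (⟨ g ⟩ x) → T (S x)
  ⟨⟩-⊆ {S} S-sub {g} g∈S x x∈⟨g⟩ with ∈⟨⟩⁻ g x x∈⟨g⟩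
  ... | k , refl = ^∈ k
    where
    open Subgroup S S-sub
    ^∈ : ∀ k → T (S (g ^ k))
    ^∈ zero    = e∈
    ^∈ (suc k) = ·∈ _ _ g∈S (^∈ k)

  -- ℤ is torsion-free: ψ (w ^ j) = j ψ w by additivity, and w ^ (r + 1) = e.
  additive-on-⟨⟩⇒≡0 : ∀ w (ψ : Fin n → ℤ) →
    (∀ g h → T (⟨ w ⟩ g) → T (⟨ w ⟩ h) → ψ h - ψ (g · h) + ψ g ≡ 0ℤ) → ψ w ≡ 0ℤ
  additive-on-⟨⟩⇒≡0 w ψ additive = ℤP.*-cancelˡ-≡ (+ suc r) (ψ w) 0ℤ (begin
    + suc r * ψ w   ≡⟨ sym (ψ-^ (suc r)) ⟩
    ψ (w ^ suc r)   ≡⟨ cong ψ (proj₁ (proj₂ (order w))) ⟩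
    ψ e             ≡⟨ ψe≡0 ⟩
    0ℤ              ≡⟨ sym (ℤP.*-zeroʳ (+ suc r)) ⟩
    + suc r * 0ℤ    ∎)
    where
    open ≡-Reasoning
    r = proj₁ (order w)
    ψe≡0 : ψ e ≡ 0ℤ
    ψe≡0 = trans (three-terms (ψ e)) (trans (cong (λ u → ψ e - u + ψ e) (cong ψ (sym (idˡ e))))
      (additive e e (^∈⟨⟩ w 0) (^∈⟨⟩ w 0)))
      where
      three-terms : ∀ a → a ≡ a - a + a
      three-terms = solve-∀
    ψ-^ : ∀ j → ψ (w ^ j) ≡ + j * ψ w
    ψ-^ zero    = ψe≡0
    ψ-^ (suc j) = begin
      ψ (w · w ^ j)                                      ≡⟨ regroup (ψ (w ^ j)) (ψ (w · w ^ j)) (ψ w) ⟩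
      ψ (w ^ j) + ψ w - (ψ (w ^ j) - ψ (w · w ^ j) + ψ w) ≡⟨ cong₂ (λ u v → u + ψ w - v) (ψ-^ j) (additive w (w ^ j) w∈⟨w⟩ (^∈⟨⟩ w j)) ⟩
      + j * ψ w + ψ w - 0ℤ                              ≡⟨ regroup' (+ j) (ψ w) ⟩
      + suc j * ψ w                                     ∎
      where
      w∈⟨w⟩ : T (⟨ w ⟩ w)
      w∈⟨w⟩ = subst (λ z → T (⟨ w ⟩ z)) (idʳ w) (^∈⟨⟩ w 1)
      regroup : ∀ a b c → b ≡ a + c - (a - b + c)
      regroup = solve-∀
      regroup' : ∀ j a → j * a + a - 0ℤ ≡ (+ 1 + j) * a
      regroup' = solve-∀

-- An element of J_{G/K} is a function modulo constants, so it is determined by its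
-- differences Δ a x y = a x - a y; this turns every statement about J-valued cochains
-- into an identity between integers.
module Differences (G : FinGroup) where
  open GroupFacts G

  El : Subset G → Set
  El K = GMod.Carrier (J G K)

  Δ : ∀ {K} → El K → Fin n → Fin n → ℤ
  Δ a x y = proj₁ a x - proj₁ a y

  Δδ¹ : ∀ {K} → (Fin n → El K) → Fin n → Fin n → Fin n → Fin n → ℤ
  Δδ¹ b g h x y = Δ (b h) (g ⁻¹ · x) (g ⁻¹ · y) - Δ (b (g · h)) x y + Δ (b g) x y

  Δδ² : ∀ {K} → (Fin n → Fin n → El K) → Fin n → Fin n → Fin n → Fin n → Fin n → ℤ
  Δδ² c g h k x y = Δ (c h k) (g ⁻¹ · x) (g ⁻¹ · y) - Δ (c (g · h) k) x y + Δ (c g (h · k)) x y - Δ (c g h) x y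

  scale : ∀ {K} → ℤ → El K → El K
  scale z a = (λ x → z * proj₁ a x) , (λ x k k∈K → cong (λ w → z * w) (proj₂ a x k k∈K))

  Δ-scale : ∀ {K} z (a : El K) x y → Δ (scale z a) x y ≡ z * Δ a x y
  Δ-scale z a x y = factor z (proj₁ a x) (proj₁ a y)
    where
    factor : ∀ z u v → z * u - z * v ≡ z * (u - v)
    factor = solve-∀

  sumEl : ∀ {K} → Subset G → (Fin n → El K) → El K
  sumEl P F = (λ x → sumOver P (λ k → proj₁ (F k) x))
            , (λ x j j∈K → sumOver-cong P (λ k _ → proj₂ (F k) x j j∈K))

  Δ-sumEl : ∀ {K} P (F : Fin n → El K) x y → Δ (sumEl P F) x y ≡ sumOver P (λ k → Δ (F k) x y)
  Δ-sumEl P F x y = sym (sumOver-- P (λ k → proj₁ (F k) x) (λ k → proj₁ (F k) y))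

  Δδ¹-scale : ∀ {K} u (b : Fin n → El K) g h x y → Δδ¹ (λ z → scale u (b z)) g h x y ≡ u * Δδ¹ b g h x y
  Δδ¹-scale u b g h x y = trans
    (cong₂ (λ s t → s - t + Δ (scale u (b g)) x y) (Δ-scale u (b h) _ _) (Δ-scale u (b (g · h)) x y))
    (trans (cong (λ w → u * Δ (b h) (g ⁻¹ · x) (g ⁻¹ · y) - u * Δ (b (g · h)) x y + w) (Δ-scale u (b g) x y))
      (factor u (Δ (b h) (g ⁻¹ · x) (g ⁻¹ · y)) (Δ (b (g · h)) x y) (Δ (b g) x y)))
    where
    factor : ∀ u a c e → u * a - u * c + u * e ≡ u * (a - c + e)
    factor = solve-∀

  Δδ²-scale : ∀ {K} u (c : Fin n → Fin n → El K) g h k x y →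
    Δδ² (λ s t → scale u (c s t)) g h k x y ≡ u * Δδ² c g h k x y
  Δδ²-scale u c g h k x y = factor u (proj₁ (c h k) (g ⁻¹ · x)) (proj₁ (c (g · h) k) x) (proj₁ (c g (h · k)) x)
    (proj₁ (c g h) x) (proj₁ (c h k) (g ⁻¹ · y)) (proj₁ (c (g · h) k) y) (proj₁ (c g (h · k)) y) (proj₁ (c g h) y)
    where
    factor : ∀ u a b c d a' b' c' d' → (u * a - u * a') - (u * b - u * b') + (u * c - u * c') - (u * d - u * d')
      ≡ u * ((a - a') - (b - b') + (c - c') - (d - d'))
    factor = solve-∀

  module Coordinates (K : Subset G) where
    open GMod (J G K) public using (_≈_; 𝟘; act) renaming (_+_ to _⊹_; -_ to ⊝_)
    open Coh G (J G K) public using (C¹; C²; δ¹; δ²; _⊛_; _⊕_; IsCocycle; Cohomologous; IsTrivialClass; ResVanishes; Ш²; PrimeToP)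

    ≈⇒Δ≡ : ∀ {a b} → a ≈ b → ∀ x y → Δ a x y ≡ Δ b x y
    ≈⇒Δ≡ {a} {b} (c , a≡b+c) x y = trans (cong₂ _-_ (a≡b+c x) (a≡b+c y)) (shift-cancels (proj₁ b x) (proj₁ b y) c)
      where
      shift-cancels : ∀ u v c → (u + c) - (v + c) ≡ u - v
      shift-cancels = solve-∀

    Δ≡⇒≈ : ∀ {a b} → (∀ x y → Δ a x y ≡ Δ b x y) → a ≈ b
    Δ≡⇒≈ {a} {b} Δa≡Δb = (proj₁ a e - proj₁ b e) , (λ x → rearrange (proj₁ a x) (proj₁ a e) (proj₁ b x) (proj₁ b e) (Δa≡Δb x e))
      where
      rearrange : ∀ u v s t → u - v ≡ s - t → u ≡ s + (v - t)
      rearrange u v s t eq = trans (add-back u v) (trans (cong (_+ v) eq) (regroup s t v))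
        where
        add-back : ∀ u v → u ≡ (u - v) + v
        add-back = solve-∀
        regroup : ∀ s t v → (s - t) + v ≡ s + (v - t)
        regroup = solve-∀

    Δ-+ : ∀ (a b : El K) x y → Δ (a ⊹ b) x y ≡ Δ a x y + Δ b x y
    Δ-+ a b x y = regroup (proj₁ a x) (proj₁ b x) (proj₁ a y) (proj₁ b y)
      where
      regroup : ∀ a b c d → (a + b) - (c + d) ≡ (a - c) + (b - d)
      regroup = solve-∀

    Δ-neg : ∀ (a : El K) x y → Δ (⊝ a) x y ≡ - Δ a x y
    Δ-neg a x y = regroup (proj₁ a x) (proj₁ a y)
      where
      regroup : ∀ u v → - u - - v ≡ - (u - v)
      regroup = solve-∀

    Δ-⊛ : ∀ m c g h x y → Δ ((m ⊛ c) g h) x y ≡ + m * Δ (c g h) x y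
    Δ-⊛ zero    c g h x y = refl
    Δ-⊛ (suc m) c g h x y = trans (Δ-+ (c g h) ((m ⊛ c) g h) x y)
      (trans (cong (λ w → Δ (c g h) x y + w) (Δ-⊛ m c g h x y)) (regroup (Δ (c g h) x y) (+ m)))
      where
      regroup : ∀ u m → u + m * u ≡ (+ 1 + m) * u
      regroup = solve-∀

    Δ-δ¹ : ∀ b g h x y → Δ (δ¹ b g h) x y ≡ Δδ¹ b g h x y
    Δ-δ¹ b g h x y = regroup (proj₁ (b h) (g ⁻¹ · x)) (proj₁ (b (g · h)) x) (proj₁ (b g) x)
                             (proj₁ (b h) (g ⁻¹ · y)) (proj₁ (b (g · h)) y) (proj₁ (b g) y)
      where
      regroup : ∀ (a b c d e f : ℤ) → ((a + - b) + c) - ((d + - e) + f) ≡ (a - d) - (b - e) + (c - f)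
      regroup = solve-∀

    Δ-δ² : ∀ c g h k x y → Δ (δ² c g h k) x y ≡ Δδ² c g h k x y
    Δ-δ² c g h k x y = regroup (proj₁ (c h k) (g ⁻¹ · x)) (proj₁ (c (g · h) k) x) (proj₁ (c g (h · k)) x)
      (proj₁ (c g h) x) (proj₁ (c h k) (g ⁻¹ · y)) (proj₁ (c (g · h) k) y) (proj₁ (c g (h · k)) y) (proj₁ (c g h) y)
      where
      regroup : ∀ (a b c d a' b' c' d' : ℤ) → (((a + - b) + c) + - d) - (((a' + - b') + c') + - d')
        ≡ (a - a') - (b - b') + (c - c') - (d - d')
      regroup = solve-∀

    Δδ¹-+ : ∀ (b b' : Fin n → El K) g h x y → Δδ¹ (λ z → b z ⊹ b' z) g h x y ≡ Δδ¹ b g h x y + Δδ¹ b' g h x y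
    Δδ¹-+ b b' g h x y = trans
      (cong₂ (λ u v → u - v + Δ (b g ⊹ b' g) x y) (Δ-+ (b h) (b' h) _ _) (Δ-+ (b (g · h)) (b' (g · h)) x y))
      (trans (cong (λ w → Δ (b h) gx gy + Δ (b' h) gx gy - (Δ (b (g · h)) x y + Δ (b' (g · h)) x y) + w) (Δ-+ (b g) (b' g) x y))
        (regroup (Δ (b h) gx gy) (Δ (b' h) gx gy) (Δ (b (g · h)) x y) (Δ (b' (g · h)) x y) (Δ (b g) x y) (Δ (b' g) x y)))
      where
      gx = g ⁻¹ · x
      gy = g ⁻¹ · y
      regroup : ∀ a a' c c' e e' → a + a' - (c + c') + (e + e') ≡ (a - c + e) + (a' - c' + e')
      regroup = solve-∀

    Δδ¹-neg : ∀ (b : Fin n → El K) g h x y → Δδ¹ (λ z → ⊝ b z) g h x y ≡ - Δδ¹ b g h x y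
    Δδ¹-neg b g h x y = trans
      (cong₂ (λ u v → u - v + Δ (⊝ b g) x y) (Δ-neg (b h) _ _) (Δ-neg (b (g · h)) x y))
      (trans (cong (λ w → - Δ (b h) (g ⁻¹ · x) (g ⁻¹ · y) - - Δ (b (g · h)) x y + w) (Δ-neg (b g) x y))
        (regroup (Δ (b h) (g ⁻¹ · x) (g ⁻¹ · y)) (Δ (b (g · h)) x y) (Δ (b g) x y)))
      where
      regroup : ∀ a c e → - a - - c + - e ≡ - (a - c + e)
      regroup = solve-∀

    isCocycle⇒Δδ²≡0 : ∀ {c} → IsCocycle c → ∀ g h k x y → Δδ² c g h k x y ≡ 0ℤ
    isCocycle⇒Δδ²≡0 {c} c-cocycle g h k x y = trans (sym (Δ-δ² c g h k x y)) (≈⇒Δ≡ {δ² c g h k} {𝟘} (c-cocycle g h k) x y)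

    Δδ²≡0⇒isCocycle : ∀ {c} → (∀ g h k x y → Δδ² c g h k x y ≡ 0ℤ) → IsCocycle c
    Δδ²≡0⇒isCocycle {c} Δδ²≡0 g h k = Δ≡⇒≈ {δ² c g h k} {𝟘} (λ x y → trans (Δ-δ² c g h k x y) (Δδ²≡0 g h k x y))

    Δ-cohomologous : ∀ {c c'} b → (∀ g h x y → Δ (c g h) x y ≡ Δ (c' g h) x y + Δδ¹ b g h x y) → Cohomologous c c'
    Δ-cohomologous {c} {c'} b eq = b , λ g h → Δ≡⇒≈ {c g h} {c' g h ⊹ δ¹ b g h} λ x y → trans (eq g h x y)
      (sym (trans (Δ-+ (c' g h) (δ¹ b g h) x y) (cong (λ w → Δ (c' g h) x y + w) (Δ-δ¹ b g h x y))))

    cohomologous-Δ : ∀ {c c'} → Cohomologous c c' →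
      Σ (Fin n → El K) λ b → ∀ g h x y → Δ (c g h) x y ≡ Δ (c' g h) x y + Δδ¹ b g h x y
    cohomologous-Δ {c} {c'} (b , c≈c'+δb) = b , λ g h x y → trans (≈⇒Δ≡ {c g h} {c' g h ⊹ δ¹ b g h} (c≈c'+δb g h) x y)
      (trans (Δ-+ (c' g h) (δ¹ b g h) x y) (cong (λ w → Δ (c' g h) x y + w) (Δ-δ¹ b g h x y)))

    Δ-isTrivialClass : ∀ {c} b → (∀ g h x y → Δ (c g h) x y ≡ Δδ¹ b g h x y) → IsTrivialClass c
    Δ-isTrivialClass {c} b eq = b , λ g h → Δ≡⇒≈ {c g h} {δ¹ b g h} λ x y → trans (eq g h x y) (sym (Δ-δ¹ b g h x y))

    isTrivialClass-Δ : ∀ {c} → IsTrivialClass c → Σ (Fin n → El K) λ b → ∀ g h x y → Δ (c g h) x y ≡ Δδ¹ b g h x y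
    isTrivialClass-Δ {c} (b , c≈δb) = b , λ g h x y → trans (≈⇒Δ≡ {c g h} {δ¹ b g h} (c≈δb g h) x y) (Δ-δ¹ b g h x y)

    Δ-resVanishes : ∀ {c} D b → (∀ g h → T (D g) → T (D h) → ∀ x y → Δ (c g h) x y ≡ Δδ¹ b g h x y) → ResVanishes D c
    Δ-resVanishes {c} D b eq = b , λ g h g∈D h∈D → Δ≡⇒≈ {c g h} {δ¹ b g h} λ x y → trans (eq g h g∈D h∈D x y) (sym (Δ-δ¹ b g h x y))

    resVanishes-Δ : ∀ {c} D → ResVanishes D c →
      Σ (Fin n → El K) λ b → ∀ g h → T (D g) → T (D h) → ∀ x y → Δ (c g h) x y ≡ Δδ¹ b g h x y
    resVanishes-Δ {c} D (b , c≈δb) = b , λ g h g∈D h∈D x y → trans (≈⇒Δ≡ {c g h} {δ¹ b g h} (c≈δb g h g∈D h∈D) x y) (Δ-δ¹ b g h x y)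

    bézout-cohomologous : ∀ {c c' a b} → BézoutIdentity a b → (B₁ B₂ : Fin n → El K) →
      (∀ g h x y → + a * (Δ (c g h) x y - Δ (c' g h) x y) ≡ Δδ¹ B₁ g h x y) →
      (∀ g h x y → + b * (Δ (c g h) x y - Δ (c' g h) x y) ≡ Δδ¹ B₂ g h x y) → Cohomologous c c'
    bézout-cohomologous {c} {c'} {a} {b} (u , v , ua+vb≡1) B₁ B₂ a-kills b-kills =
      Δ-cohomologous {c} {c'} β λ g h x y → let X = Δ (c g h) x y ; X' = Δ (c' g h) x y in begin
        X                                                   ≡⟨ sym (one-times X X') ⟩
        X' + + 1 * (X - X')                                 ≡⟨ cong (λ w → X' + w * (X - X')) (sym ua+vb≡1) ⟩
        X' + (u * + a + v * + b) * (X - X')                 ≡⟨ sym (distribute X X' u v (+ a) (+ b)) ⟩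
        X' + (u * (+ a * (X - X')) + v * (+ b * (X - X')))  ≡⟨ cong₂ (λ s t → X' + (u * s + v * t)) (a-kills g h x y) (b-kills g h x y) ⟩
        X' + (u * Δδ¹ B₁ g h x y + v * Δδ¹ B₂ g h x y)      ≡⟨ cong (λ w → X' + w) (sym (Δδ¹-β g h x y)) ⟩
        X' + Δδ¹ β g h x y                                  ∎
      where
      open ≡-Reasoning
      β : Fin n → El K
      β z = scale u (B₁ z) ⊹ scale v (B₂ z)
      Δδ¹-β : ∀ g h x y → Δδ¹ β g h x y ≡ u * Δδ¹ B₁ g h x y + v * Δδ¹ B₂ g h x y
      Δδ¹-β g h x y = trans (Δδ¹-+ (λ z → scale u (B₁ z)) (λ z → scale v (B₂ z)) g h x y)
                            (cong₂ _+_ (Δδ¹-scale u B₁ g h x y) (Δδ¹-scale v B₂ g h x y))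
      one-times : ∀ X X' → X' + + 1 * (X - X') ≡ X
      one-times = solve-∀
      distribute : ∀ X X' u v A B → X' + (u * (A * (X - X')) + v * (B * (X - X'))) ≡ X' + (u * A + v * B) * (X - X')
      distribute = solve-∀

module Trace (G : FinGroup) (N H : Subset G) (N-sub : IsSubgroup G N) (N-normal : IsNormal G N) (H-sub : IsSubgroup G H) where
  open GroupFacts G
  open Differences G
  open Subgroup N N-sub
  open Normal N N-normal
  module SH = Subgroup H H-sub

  K : Subset G
  K = prodSub G N H

  module JK = Coordinates K
  module JH = Coordinates H

  q : ℕ
  q = card G N

  N⊆K : ∀ k → T (N k) → T (K k)
  N⊆K k k∈N = subst (λ z → T (K z)) (idʳ k) (∈-prodSub⁺ {N} {H} k e k∈N SH.e∈)

  H⊆K : ∀ k → T (H k) → T (K k)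
  H⊆K k k∈H = subst (λ z → T (K z)) (idˡ k) (∈-prodSub⁺ {N} {H} e k e∈ k∈H)

  -- (trace a) x = Σ_{k ∈ N} a (x k): on the basis this is gH ↦ #(N ∩ H) · gNH.
  trace : El H → El K
  trace a = (λ x → sumOver N (λ k → proj₁ a (x · k))) , K-invariant
    where
    K-invariant : RInv G K (λ x → sumOver N (λ k → proj₁ a (x · k)))
    K-invariant x sh sh∈K with ∈-prodSub⁻ sh sh∈K
    ... | s , h , s∈N , h∈H , refl = begin
      sumOver N (λ k → proj₁ a ((x · (s · h)) · k))     ≡⟨ sumOver-cong N (λ k _ → move-h k) ⟩
      sumOver N (λ k → proj₁ a ((x · s) · conj h k))    ≡⟨ sumOver-conj h (λ k → proj₁ a ((x · s) · k)) ⟩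
      sumOver N (λ k → proj₁ a ((x · s) · k))           ≡⟨ sumOver-cong N (λ k _ → cong (proj₁ a) (assoc x s k)) ⟩
      sumOver N (λ k → proj₁ a (x · (s · k)))           ≡⟨ sumOver-·ˡ s s∈N (λ k → proj₁ a (x · k)) ⟩
      sumOver N (λ k → proj₁ a (x · k))                 ∎
      where
      open ≡-Reasoning
      move-h : ∀ k → proj₁ a ((x · (s · h)) · k) ≡ proj₁ a ((x · s) · conj h k)
      move-h k = trans (cong (proj₁ a) (sym (begin
        ((x · s) · conj h k) · h          ≡⟨ assoc _ _ _ ⟩
        (x · s) · (((h · k) · h ⁻¹) · h)  ≡⟨ cong ((x · s) ·_) ([yx⁻¹]x≡y h (h · k)) ⟩
        (x · s) · (h · k)                 ≡⟨ sym (assoc _ _ _) ⟩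
        ((x · s) · h) · k                 ≡⟨ cong (_· k) (assoc x s h) ⟩
        (x · (s · h)) · k                 ∎)))
        (proj₂ a _ h h∈H)

  inclusion : El K → El H
  inclusion a = proj₁ a , (λ x h h∈H → proj₂ a x h (H⊆K h h∈H))

  trace∘inclusion : ∀ (a : El K) x → proj₁ (trace (inclusion a)) x ≡ + q * proj₁ a x
  trace∘inclusion a x = trans (sumOver-cong N (λ k k∈N → proj₂ a x k (N⊆K k k∈N))) (sumOver-const N G (proj₁ a x))

  trace-left : ∀ (a : El H) x → proj₁ (trace a) x ≡ sumOver N (λ m → proj₁ a (m ⁻¹ · x))
  trace-left a x = sym (begin
    sumOver N (λ m → proj₁ a (m ⁻¹ · x))            ≡⟨ sumOver-cong N (λ m _ → cong (proj₁ a) (sym (x·conj[x⁻¹,m]≡m·x x (m ⁻¹)))) ⟩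
    sumOver N (λ m → proj₁ a (x · conj (x ⁻¹) (m ⁻¹))) ≡⟨ sumOver-⁻¹ (λ m → proj₁ a (x · conj (x ⁻¹) m)) ⟩
    sumOver N (λ m → proj₁ a (x · conj (x ⁻¹) m))   ≡⟨ sumOver-conj (x ⁻¹) (λ m → proj₁ a (x · m)) ⟩
    sumOver N (λ m → proj₁ a (x · m))               ∎)
    where open ≡-Reasoning

  Δ-trace : ∀ a x y → Δ (trace a) x y ≡ sumOver N (λ k → Δ a (x · k) (y · k))
  Δ-trace a x y = sym (sumOver-- N (λ k → proj₁ a (x · k)) (λ k → proj₁ a (y · k)))

  Δ-trace-left : ∀ a x y → Δ (trace a) x y ≡ sumOver N (λ m → Δ a (m ⁻¹ · x) (m ⁻¹ · y))
  Δ-trace-left a x y = trans (cong₂ _-_ (trace-left a x) (trace-left a y)) (sym (sumOver-- N _ _))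

  Δ-trace-⁻¹· : ∀ a g x y → Δ (trace a) (g ⁻¹ · x) (g ⁻¹ · y) ≡ sumOver N (λ k → Δ a (g ⁻¹ · (x · k)) (g ⁻¹ · (y · k)))
  Δ-trace-⁻¹· a g x y = trans (Δ-trace a _ _) (sumOver-cong N (λ k _ → cong₂ (Δ a) (assoc _ _ _) (assoc _ _ _)))

  Δδ¹-trace : ∀ (b : Fin n → El H) g h x y → Δδ¹ (λ z → trace (b z)) g h x y ≡ sumOver N (λ k → Δδ¹ b g h (x · k) (y · k))
  Δδ¹-trace b g h x y = begin
    Δδ¹ (λ z → trace (b z)) g h x y
      ≡⟨ cong₂ (λ u v → u - v + Δ (trace (b g)) x y) (Δ-trace-⁻¹· (b h) g x y) (Δ-trace (b (g · h)) x y) ⟩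
    S₁ - S₂ + Δ (trace (b g)) x y
      ≡⟨ cong (λ w → S₁ - S₂ + w) (Δ-trace (b g) x y) ⟩
    S₁ - S₂ + sumOver N (λ k → Δ (b g) (x · k) (y · k))
      ≡⟨ sym (sumOver-[f-g+h] N _ _ _) ⟩
    sumOver N (λ k → Δδ¹ b g h (x · k) (y · k)) ∎
    where
    open ≡-Reasoning
    S₁ = sumOver N (λ k → Δ (b h) (g ⁻¹ · (x · k)) (g ⁻¹ · (y · k)))
    S₂ = sumOver N (λ k → Δ (b (g · h)) (x · k) (y · k))

  Δδ²-trace : ∀ (c : Fin n → Fin n → El H) g h k x y →
    Δδ² (λ u v → trace (c u v)) g h k x y ≡ sumOver N (λ j → Δδ² c g h k (x · j) (y · j))
  Δδ²-trace c g h k x y = begin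
    Δδ² (λ u v → trace (c u v)) g h k x y
      ≡⟨ cong₂ (λ u v → u - v + Δ (trace (c g (h · k))) x y - Δ (trace (c g h)) x y)
               (Δ-trace-⁻¹· (c h k) g x y) (Δ-trace (c (g · h) k) x y) ⟩
    S₁ - S₂ + Δ (trace (c g (h · k))) x y - Δ (trace (c g h)) x y
      ≡⟨ cong₂ (λ u v → S₁ - S₂ + u - v) (Δ-trace (c g (h · k)) x y) (Δ-trace (c g h) x y) ⟩
    S₁ - S₂ + sumOver N (λ j → Δ (c g (h · k)) (x · j) (y · j)) - sumOver N (λ j → Δ (c g h) (x · j) (y · j))
      ≡⟨ sym (sumOver-[f-g+h-j] N _ _ _ _) ⟩
    sumOver N (λ j → Δδ² c g h k (x · j) (y · j)) ∎
    where
    open ≡-Reasoning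
    S₁ = sumOver N (λ j → Δ (c h k) (g ⁻¹ · (x · j)) (g ⁻¹ · (y · j)))
    S₂ = sumOver N (λ j → Δ (c (g · h) k) (x · j) (y · j))

  trace² : JH.C² → JK.C²
  trace² c g h = trace (c g h)

  trace²-Ш² : ∀ 𝒟 c → JH.Ш² 𝒟 c → JK.Ш² 𝒟 (trace² c)
  trace²-Ш² 𝒟 c (c-cocycle , c-res) = JK.Δδ²≡0⇒isCocycle {trace² c} cocycle , res
    where
    cocycle : ∀ g h k x y → Δδ² (trace² c) g h k x y ≡ 0ℤ
    cocycle g h k x y = trans (Δδ²-trace c g h k x y)
      (sumOver-zero N _ (λ j → JH.isCocycle⇒Δδ²≡0 {c} c-cocycle g h k (x · j) (y · j)))
    res : ∀ D → 𝒟 D → JK.ResVanishes D (trace² c)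
    res D D∈𝒟 with JH.resVanishes-Δ {c} D (c-res D D∈𝒟)
    ... | b , c≡δb = JK.Δ-resVanishes {trace² c} D (λ z → trace (b z)) λ g h g∈D h∈D x y →
      trans (Δ-trace (c g h) x y) (trans (sumOver-cong N (λ j _ → c≡δb g h g∈D h∈D (x · j) (y · j))) (sym (Δδ¹-trace b g h x y)))

  trace²-cohomologous : ∀ c c' → JH.Cohomologous c c' → JK.Cohomologous (trace² c) (trace² c')
  trace²-cohomologous c c' c~c' with JH.cohomologous-Δ {c} {c'} c~c'
  ... | b , c≡c'+δb = JK.Δ-cohomologous {trace² c} {trace² c'} (λ z → trace (b z)) λ g h x y → begin
    Δ (trace (c g h)) x y
      ≡⟨ Δ-trace (c g h) x y ⟩
    sumOver N (λ j → Δ (c g h) (x · j) (y · j))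
      ≡⟨ sumOver-cong N (λ j _ → c≡c'+δb g h (x · j) (y · j)) ⟩
    sumOver N (λ j → Δ (c' g h) (x · j) (y · j) + Δδ¹ b g h (x · j) (y · j))
      ≡⟨ sumOver-+ N _ _ ⟩
    _ ≡⟨ cong₂ _+_ (sym (Δ-trace (c' g h) x y)) (sym (Δδ¹-trace b g h x y)) ⟩
    Δ (trace (c' g h)) x y + Δδ¹ (λ z → trace (b z)) g h x y ∎
    where open ≡-Reasoning

  trace²-⊕ : ∀ c c' → JK.Cohomologous (trace² (c JH.⊕ c')) (trace² c JK.⊕ trace² c')
  trace²-⊕ c c' = JK.Δ-cohomologous {trace² (c JH.⊕ c')} {trace² c JK.⊕ trace² c'} (λ _ → JK.𝟘) λ g h x y → begin
    Δ (trace (c g h JH.⊹ c' g h)) x y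
      ≡⟨ Δ-trace (c g h JH.⊹ c' g h) x y ⟩
    sumOver N (λ j → Δ (c g h JH.⊹ c' g h) (x · j) (y · j))
      ≡⟨ sumOver-cong N (λ j _ → JH.Δ-+ (c g h) (c' g h) (x · j) (y · j)) ⟩
    sumOver N (λ j → Δ (c g h) (x · j) (y · j) + Δ (c' g h) (x · j) (y · j))
      ≡⟨ sumOver-+ N _ _ ⟩
    _ ≡⟨ cong₂ _+_ (sym (Δ-trace (c g h) x y)) (sym (Δ-trace (c' g h) x y)) ⟩
    Δ (trace (c g h)) x y + Δ (trace (c' g h)) x y
      ≡⟨ sym (JK.Δ-+ (trace (c g h)) (trace (c' g h)) x y) ⟩
    Δ (trace (c g h) JK.⊹ trace (c' g h)) x y
      ≡⟨ sym (ℤP.+-identityʳ _) ⟩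
    Δ (trace (c g h) JK.⊹ trace (c' g h)) x y + 0ℤ ∎
    where open ≡-Reasoning

  traceCorrection : JH.C² → Fin n → El H
  traceCorrection c z = sumEl N (λ m → c m z) JH.⊹ (JH.⊝ sumEl N (λ m → c z m))

  -- Sum the cocycle identity of c over m ∈ N placed in each of its three slots.
  Δ-trace-cocycle : ∀ c → JH.IsCocycle c → ∀ g h x y →
    Δ (trace (c g h)) x y ≡ + q * Δ (c g h) x y + Δδ¹ (traceCorrection c) g h x y
  Δ-trace-cocycle c c-cocycle g h x y = ℤP.i-j≡0⇒i≡j _ _ (begin
    Δ (trace (c g h)) x y - (qΔ + Δδ¹ (traceCorrection c) g h x y)
      ≡⟨ cong₂ (λ u v → u - (qΔ + v)) (Δ-trace-left (c g h) x y) Δδ¹-correction ⟩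
    S₁ - (qΔ + ((A h gx gy - B h gx gy) - (A (g · h) x y - B (g · h) x y) + (A g x y - B g x y)))
      ≡⟨ regroup S₁ S₂ S₃ (A h gx gy) (A (g · h) x y) (A g x y) (B h gx gy) (B (g · h) x y) (B g x y) qΔ ⟩
    (S₁ - S₂ + A (g · h) x y - A g x y) - (A h gx gy - S₂ + S₃ - B g x y) + (B h gx gy - B (g · h) x y + S₃ - qΔ)
      ≡⟨ sym (cong₂ _+_ (cong₂ _-_ first-slot second-slot) third-slot) ⟩
    sumOver N (λ m → Δδ² c m g h x y) - sumOver N (λ m → Δδ² c g m h x y) + sumOver N (λ m → Δδ² c g h m x y)
      ≡⟨ cong₂ _+_ (cong₂ _-_ (vanishes (λ m → m , g , h)) (vanishes (λ m → g , m , h))) (vanishes (λ m → g , h , m)) ⟩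
    0ℤ ∎)
    where
    open ≡-Reasoning
    gx = g ⁻¹ · x
    gy = g ⁻¹ · y
    qΔ = + q * Δ (c g h) x y
    A B : Fin n → Fin n → Fin n → ℤ
    A z u v = sumOver N (λ m → Δ (c m z) u v)
    B z u v = sumOver N (λ m → Δ (c z m) u v)
    S₁ S₂ S₃ : ℤ
    S₁ = sumOver N (λ m → Δ (c g h) (m ⁻¹ · x) (m ⁻¹ · y))
    S₂ = sumOver N (λ m → Δ (c (g · m) h) x y)
    S₃ = sumOver N (λ m → Δ (c g (h · m)) x y)
    vanishes : (slots : Fin n → Fin n × Fin n × Fin n) →
      sumOver N (λ m → let (u , v , w) = slots m in Δδ² c u v w x y) ≡ 0ℤ
    vanishes slots = sumOver-zero N _ (λ m → let (u , v , w) = slots m in JH.isCocycle⇒Δδ²≡0 {c} c-cocycle u v w x y)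
    Δ-correction : ∀ z u v → Δ (traceCorrection c z) u v ≡ A z u v - B z u v
    Δ-correction z u v = trans (JH.Δ-+ (sumEl N (λ m → c m z)) (JH.⊝ (sumEl N (λ m → c z m))) u v)
      (cong₂ _+_ (Δ-sumEl N (λ m → c m z) u v) (trans (JH.Δ-neg (sumEl N (λ m → c z m)) u v) (cong -_ (Δ-sumEl N (λ m → c z m) u v))))
    Δδ¹-correction : Δδ¹ (traceCorrection c) g h x y
      ≡ (A h gx gy - B h gx gy) - (A (g · h) x y - B (g · h) x y) + (A g x y - B g x y)
    Δδ¹-correction = cong₂ _+_ (cong₂ _-_ (Δ-correction h gx gy) (Δ-correction (g · h) x y)) (Δ-correction g x y)
    conj-slot : ∀ a (f : Fin n → ℤ) → sumOver N (λ m → f (m · a)) ≡ sumOver N (λ m → f (a · m))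
    conj-slot a f = trans (sym (sumOver-conj a (λ m → f (m · a))))
      (sumOver-cong N (λ m _ → cong f ([yx⁻¹]x≡y a (a · m))))
    first-slot : sumOver N (λ m → Δδ² c m g h x y) ≡ S₁ - S₂ + A (g · h) x y - A g x y
    first-slot = trans (sumOver-[f-g+h-j] N _ _ _ _)
      (cong (λ w → S₁ - w + A (g · h) x y - A g x y) (conj-slot g (λ z → Δ (c z h) x y)))
    second-slot : sumOver N (λ m → Δδ² c g m h x y) ≡ A h gx gy - S₂ + S₃ - B g x y
    second-slot = trans (sumOver-[f-g+h-j] N _ _ _ _)
      (cong (λ w → A h gx gy - S₂ + w - B g x y) (conj-slot h (λ z → Δ (c g z) x y)))
    third-slot : sumOver N (λ m → Δδ² c g h m x y) ≡ B h gx gy - B (g · h) x y + S₃ - qΔ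
    third-slot = trans (sumOver-[f-g+h-j] N _ _ _ _)
      (cong (λ w → B h gx gy - B (g · h) x y + S₃ - w) (sumOver-const N G (Δ (c g h) x y)))
    regroup : ∀ s₁ s₂ s₃ a₁ a₂ a₃ b₁ b₂ b₃ t → s₁ - (t + ((a₁ - b₁) - (a₂ - b₂) + (a₃ - b₃)))
      ≡ (s₁ - s₂ + a₂ - a₃) - (a₁ - s₂ + s₃ - b₃) + (b₁ - b₂ + s₃ - t)
    regroup = solve-∀

module IndexKillsШ² (G : FinGroup) (N : Subset G) (N-sub : IsSubgroup G N) (N-normal : IsNormal G N)
  (K : Subset G) (N⊆K : ∀ k → T (N k) → T (K k))
  (𝒟 : Subset G → Set) (cyclic∈𝒟 : ∀ C → IsCyclicSubgroup G C → 𝒟 C) where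
  open GroupFacts G
  open Differences G
  open Normal N N-normal
  open Cyclic G
  open Transversal G N N-sub
  open Coordinates K
  module SN = Subgroup N N-sub

  q : ℕ
  q = card G N

  whole : Subset G
  whole _ = true

  whole-sub : IsSubgroup G whole
  whole-sub = tt , (λ _ _ _ _ → tt) , (λ _ _ → tt)

  card-whole : ∀ {k} → card G {k} (λ _ → true) ≡ k
  card-whole {zero}  = refl
  card-whole {suc k} = cong suc (card-whole {k})

  N-acts-trivially : ∀ (a : El K) g → T (N g) → ∀ x → proj₁ a (g ⁻¹ · x) ≡ proj₁ a x
  N-acts-trivially a g g∈N x = trans (cong (proj₁ a) (sym (x·conj[x⁻¹,m]≡m·x x (g ⁻¹))))
    (proj₂ a x _ (N⊆K _ (subst T (sym (conj-invariant (x ⁻¹) (g ⁻¹))) (SN.⁻¹∈ g g∈N))))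

  Δ-N-invariant : ∀ (a : El K) g → T (N g) → ∀ x y → Δ a (g ⁻¹ · x) (g ⁻¹ · y) ≡ Δ a x y
  Δ-N-invariant a g g∈N x y = cong₂ _-_ (N-acts-trivially a g g∈N x) (N-acts-trivially a g g∈N y)

  module _ (d : C²) (d∈Ш² : Ш² 𝒟 d) where

    d-cocycle : ∀ g h k x y → Δδ² d g h k x y ≡ 0ℤ
    d-cocycle = isCocycle⇒Δδ²≡0 {d} (proj₁ d∈Ш²)

    sumSlot : Subset G → Fin n → Fin n → Fin n → ℤ
    sumSlot S z x y = sumOver S (λ k → Δ (d z k) x y)

    sum-cocycle : ∀ S z w x y → sumSlot S w (z ⁻¹ · x) (z ⁻¹ · y) - sumSlot S (z · w) x y
      + sumOver S (λ k → Δ (d z (w · k)) x y) ≡ + card G S * Δ (d z w) x y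
    sum-cocycle S z w x y = ℤP.i-j≡0⇒i≡j _ _ (begin
      sumSlot S w (z ⁻¹ · x) (z ⁻¹ · y) - sumSlot S (z · w) x y + sumOver S (λ k → Δ (d z (w · k)) x y)
        - + card G S * Δ (d z w) x y
        ≡⟨ cong (λ v → sumSlot S w (z ⁻¹ · x) (z ⁻¹ · y) - sumSlot S (z · w) x y + sumOver S (λ k → Δ (d z (w · k)) x y) - v)
                (sym (sumOver-const S G (Δ (d z w) x y))) ⟩
      _ ≡⟨ sym (sumOver-[f-g+h-j] S _ _ _ _) ⟩
      sumOver S (λ k → Δδ² d z w k x y) ≡⟨ sumOver-zero S _ (λ k → d-cocycle z w k x y) ⟩
      0ℤ ∎)
      where open ≡-Reasoning

    sumSlot-cocycle : ∀ S → IsSubgroup G S → ∀ z w → T (S w) → ∀ x y →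
      sumSlot S w (z ⁻¹ · x) (z ⁻¹ · y) - sumSlot S (z · w) x y + sumSlot S z x y ≡ + card G S * Δ (d z w) x y
    sumSlot-cocycle S S-sub z w w∈S x y =
      trans (cong (λ u → sumSlot S w (z ⁻¹ · x) (z ⁻¹ · y) - sumSlot S (z · w) x y + u)
                  (sym (Subgroup.sumOver-·ˡ S S-sub w w∈S (λ k → Δ (d z k) x y))))
            (sum-cocycle S z w x y)

    V : Fin n → Fin n → Fin n → ℤ
    V = sumSlot N

    V-N-invariant : ∀ z g → T (N g) → ∀ x y → V z (g ⁻¹ · x) (g ⁻¹ · y) ≡ V z x y
    V-N-invariant z g g∈N x y = trans (sym (Δ-sumEl N (λ k → d z k) _ _))
      (trans (Δ-N-invariant (sumEl N (λ k → d z k)) g g∈N x y) (Δ-sumEl N (λ k → d z k) x y))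

    restriction-trivialiser : ∀ w → Σ (Fin n → El K) λ β → ∀ g h → T (⟨ w ⟩ g) → T (⟨ w ⟩ h) → ∀ x y → Δ (d g h) x y ≡ Δδ¹ β g h x y
    restriction-trivialiser w = resVanishes-Δ {d} ⟨ w ⟩ (proj₂ d∈Ш² ⟨ w ⟩ (cyclic∈𝒟 ⟨ w ⟩ (⟨⟩-isCyclic w)))

    β : Fin n → El K
    β w = proj₁ (restriction-trivialiser w) w

    -- On ⟨w⟩ ⊆ N both V and q β trivialise q d, so their difference is additive there.
    V-on-N : ∀ w → T (N w) → ∀ x y → V w x y ≡ + q * Δ (β w) x y
    V-on-N w w∈N x y = ℤP.i-j≡0⇒i≡j _ _ (additive-on-⟨⟩⇒≡0 w ψ additive)
      where
      b = proj₁ (restriction-trivialiser w)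
      ψ : Fin n → ℤ
      ψ z = V z x y - + q * Δ (b z) x y
      regroup : ∀ (a b c u v s t : ℤ) → (a - t * u) - (b - t * v) + (c - t * s) ≡ (a - b + c) - t * (u - v + s)
      regroup = solve-∀
      additive : ∀ g h → T (⟨ w ⟩ g) → T (⟨ w ⟩ h) → ψ h - ψ (g · h) + ψ g ≡ 0ℤ
      additive g h g∈⟨w⟩ h∈⟨w⟩ = begin
        ψ h - ψ (g · h) + ψ g
          ≡⟨ regroup (V h x y) (V (g · h) x y) (V g x y) (Δ (b h) x y) (Δ (b (g · h)) x y) (Δ (b g) x y) (+ q) ⟩
        (V h x y - V (g · h) x y + V g x y) - + q * (Δ (b h) x y - Δ (b (g · h)) x y + Δ (b g) x y)
          ≡⟨ cong₂ (λ u v → u - + q * v) V-part b-part ⟩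
        + q * Δ (d g h) x y - + q * Δ (d g h) x y
          ≡⟨ ℤP.+-inverseʳ (+ q * Δ (d g h) x y) ⟩
        0ℤ ∎
        where
        open ≡-Reasoning
        g∈N = ⟨⟩-⊆ N-sub w∈N g g∈⟨w⟩
        h∈N = ⟨⟩-⊆ N-sub w∈N h h∈⟨w⟩
        V-part : V h x y - V (g · h) x y + V g x y ≡ + q * Δ (d g h) x y
        V-part = trans (cong (λ u → u - V (g · h) x y + V g x y) (sym (V-N-invariant h g g∈N x y)))
                       (sumSlot-cocycle N N-sub g h h∈N x y)
        b-part : Δ (b h) x y - Δ (b (g · h)) x y + Δ (b g) x y ≡ Δ (d g h) x y
        b-part = sym (trans (proj₂ (restriction-trivialiser w) g h g∈⟨w⟩ h∈⟨w⟩ x y)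
                   (cong (λ u → u - Δ (b (g · h)) x y + Δ (b g) x y) (Δ-N-invariant (b h) g g∈N x y)))

    V-·N : ∀ z w → T (N w) → ∀ x y →
      V (z · w) x y ≡ V z x y + + q * (Δ (β w) (z ⁻¹ · x) (z ⁻¹ · y) - Δ (d z w) x y)
    V-·N z w w∈N x y = begin
      V (z · w) x y                                   ≡⟨ regroup Vw (V (z · w) x y) (V z x y) ⟩
      Vw + V z x y - (Vw - V (z · w) x y + V z x y)   ≡⟨ cong₂ (λ u v → u + V z x y - v) (V-on-N w w∈N _ _) (sumSlot-cocycle N N-sub z w w∈N x y) ⟩
      + q * Δ (β w) (z ⁻¹ · x) (z ⁻¹ · y) + V z x y - + q * Δ (d z w) x y
        ≡⟨ regroup' (+ q) (Δ (β w) (z ⁻¹ · x) (z ⁻¹ · y)) (V z x y) (Δ (d z w) x y) ⟩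
      V z x y + + q * (Δ (β w) (z ⁻¹ · x) (z ⁻¹ · y) - Δ (d z w) x y) ∎
      where
      open ≡-Reasoning
      Vw = V w (z ⁻¹ · x) (z ⁻¹ · y)
      regroup : ∀ a b c → b ≡ a + c - (a - b + c)
      regroup = solve-∀
      regroup' : ∀ t u v s → t * u + v - t * s ≡ v + t * (u - s)
      regroup' = solve-∀

    U : Fin n → Fin n → Fin n → ℤ
    U = sumSlot whole

    -- The classical argument that #G kills H².
    U-cocycle : ∀ g h x y → U h (g ⁻¹ · x) (g ⁻¹ · y) - U (g · h) x y + U g x y ≡ + n * Δ (d g h) x y
    U-cocycle g h x y = trans (sumSlot-cocycle whole whole-sub g h tt x y)
      (cong (λ k → + k * Δ (d g h) x y) (card-whole {n}))

    V₀ : Fin n → Fin n → ℤ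
    V₀ x y = sumOver Reps (λ t → V t x y)

    -- Writing g t = rep (g t) · offset (g t) splits U g into q Z g plus the coboundary of V₀.
    Z : Fin n → El K
    Z g = sumEl Reps (λ t → d g t ⊹ (act (rep (g · t)) (β (offset (g · t))) ⊹ (⊝ d (rep (g · t)) (offset (g · t)))))

    U-decomposition : ∀ g x y → U g x y ≡ + q * Δ (Z g) x y + V₀ x y - V₀ (g ⁻¹ · x) (g ⁻¹ · y)
    U-decomposition g x y = begin
      U g x y
        ≡⟨ sym (sum-by-cosets (λ k → Δ (d g k) x y)) ⟩
      sumOver Reps (λ t → sumOver N (λ j → Δ (d g (t · j)) x y))
        ≡⟨ sumOver-cong Reps (λ t _ → per-coset t) ⟩
      sumOver Reps (λ t → + q * (X t + Φ t) + Y t - W t)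
        ≡⟨ trans (sumOver-- Reps _ W) (cong (_- sumOver Reps W) (trans (sumOver-+ Reps _ Y)
             (cong (_+ sumOver Reps Y) (sumOver-*ˡ Reps (+ q) (λ t → X t + Φ t))))) ⟩
      + q * sumOver Reps (λ t → X t + Φ t) + sumOver Reps Y - sumOver Reps W
        ≡⟨ cong₂ (λ u v → + q * u + v - sumOver Reps W) (sym Δ-Z) Y-sum ⟩
      + q * Δ (Z g) x y + V₀ x y - V₀ (g ⁻¹ · x) (g ⁻¹ · y) ∎
      where
      open ≡-Reasoning
      r o : Fin n → Fin n
      r t = rep (g · t)
      o t = offset (g · t)
      X Φ Y W : Fin n → ℤ
      X t = Δ (d g t) x y
      Φ t = Δ (β (o t)) (r t ⁻¹ · x) (r t ⁻¹ · y) - Δ (d (r t) (o t)) x y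
      Y t = V (r t) x y
      W t = V t (g ⁻¹ · x) (g ⁻¹ · y)
      over-coset : ∀ t → sumOver N (λ j → Δ (d g (t · j)) x y) ≡ + q * X t + V (g · t) x y - W t
      over-coset t = ℤP.i-j≡0⇒i≡j _ _ (trans (regroup (sumOver N (λ j → Δ (d g (t · j)) x y)) (W t) (V (g · t) x y) (+ q * X t))
        (trans (cong (λ u → u - (+ q * X t)) (sum-cocycle N g t x y)) (ℤP.+-inverseʳ (+ q * X t))))
        where
        regroup : ∀ s w v t → s - (t + v - w) ≡ (w - v + s) - t
        regroup = solve-∀
      per-coset : ∀ t → sumOver N (λ j → Δ (d g (t · j)) x y) ≡ + q * (X t + Φ t) + Y t - W t
      per-coset t = begin
        sumOver N (λ j → Δ (d g (t · j)) x y) ≡⟨ over-coset t ⟩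
        + q * X t + V (g · t) x y - W t       ≡⟨ cong (λ z → + q * X t + V z x y - W t) (sym (rep·offset (g · t))) ⟩
        + q * X t + V (r t · o t) x y - W t   ≡⟨ cong (λ u → + q * X t + u - W t) (V-·N (r t) (o t) (offset∈N (g · t)) x y) ⟩
        + q * X t + (Y t + + q * Φ t) - W t   ≡⟨ regroup (+ q) (X t) (Y t) (Φ t) (W t) ⟩
        + q * (X t + Φ t) + Y t - W t         ∎
        where
        regroup : ∀ t a b c w → t * a + (b + t * c) - w ≡ t * (a + c) + b - w
        regroup = solve-∀
      Y-sum : sumOver Reps Y ≡ V₀ x y
      Y-sum = trans (sumOver-cong Reps (λ t t∈Reps → cong (λ z → V z x y) (sym (shift-onReps g t∈Reps))))
                    (sumOver-Reps-shift g (λ t → V t x y))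
      Δ-Z : Δ (Z g) x y ≡ sumOver Reps (λ t → X t + Φ t)
      Δ-Z = trans (Δ-sumEl Reps (λ t → d g t ⊹ rest t) x y) (sumOver-cong Reps (λ t _ →
        trans (Δ-+ (d g t) (rest t) x y) (cong (λ u → X t + u)
          (trans (Δ-+ (act (r t) (β (o t))) (⊝ d (r t) (o t)) x y) (cong (λ u → Δ (β (o t)) (r t ⁻¹ · x) (r t ⁻¹ · y) + u)
            (Δ-neg (d (r t) (o t)) x y))))))
        where
        rest : Fin n → El K
        rest t = act (r t) (β (o t)) ⊹ (⊝ d (r t) (o t))

    index·d≡δZ : ∀ m → n ≡ q ℕ.* m → .{{ℕ.NonZero q}} → ∀ g h x y → + m * Δ (d g h) x y ≡ Δδ¹ Z g h x y
    index·d≡δZ m n≡qm g h x y = ℤP.*-cancelˡ-≡ (+ q) _ _ (begin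
      + q * (+ m * Δ (d g h) x y)     ≡⟨ sym (ℤP.*-assoc (+ q) (+ m) _) ⟩
      (+ q * + m) * Δ (d g h) x y     ≡⟨ cong (_* Δ (d g h) x y) (sym (ℤP.pos-* q m)) ⟩
      + (q ℕ.* m) * Δ (d g h) x y     ≡⟨ cong (λ k → + k * Δ (d g h) x y) (sym n≡qm) ⟩
      + n * Δ (d g h) x y             ≡⟨ sym (U-cocycle g h x y) ⟩
      U h gx gy - U (g · h) x y + U g x y
        ≡⟨ cong₂ (λ a b → a - b + U g x y) (U-decomposition h gx gy) U[gh] ⟩
      (+ q * Δ (Z h) gx gy + V₀ gx gy - V₀ hgx hgy) - (+ q * Δ (Z (g · h)) x y + V₀ x y - V₀ hgx hgy) + U g x y
        ≡⟨ cong (λ a → (+ q * Δ (Z h) gx gy + V₀ gx gy - V₀ hgx hgy) - (+ q * Δ (Z (g · h)) x y + V₀ x y - V₀ hgx hgy) + a)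
                (U-decomposition g x y) ⟩
      _ ≡⟨ telescope (+ q) (Δ (Z h) gx gy) (Δ (Z (g · h)) x y) (Δ (Z g) x y) (V₀ gx gy) (V₀ hgx hgy) (V₀ x y) ⟩
      + q * Δδ¹ Z g h x y ∎)
      where
      open ≡-Reasoning
      gx = g ⁻¹ · x
      gy = g ⁻¹ · y
      hgx = h ⁻¹ · gx
      hgy = h ⁻¹ · gy
      [gh]⁻¹ : ∀ z → (g · h) ⁻¹ · z ≡ h ⁻¹ · (g ⁻¹ · z)
      [gh]⁻¹ z = trans (cong (_· z) (⁻¹-anti-homo-∙ g h)) (assoc _ _ _)
      U[gh] : U (g · h) x y ≡ + q * Δ (Z (g · h)) x y + V₀ x y - V₀ hgx hgy
      U[gh] = trans (U-decomposition (g · h) x y) (cong₂ (λ a b → + q * Δ (Z (g · h)) x y + V₀ x y - V₀ a b) ([gh]⁻¹ x) ([gh]⁻¹ y))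
      telescope : ∀ t z₁ z₂ z₃ a b c → (t * z₁ + a - b) - (t * z₂ + c - b) + (t * z₃ + c - a) ≡ t * (z₁ - z₂ + z₃)
      telescope = solve-∀

  Ш²-killed-by-index : ∀ m → n ≡ q ℕ.* m → .{{ℕ.NonZero q}} → ∀ d → Ш² 𝒟 d → IsTrivialClass (m ⊛ d)
  Ш²-killed-by-index m n≡qm d d∈Ш² = Δ-isTrivialClass {m ⊛ d} (Z d d∈Ш²) λ g h x y →
    trans (Δ-⊛ m d g h x y) (index·d≡δZ d d∈Ш² m n≡qm g h x y)

module PrimeToPIsomorphism (G : FinGroup) {p : ℕ} (p-prime : Prime p)
  (N : Subset G) (N-sub : IsSubgroup G N) (N-normal : IsNormal G N) (H : Subset G) (H-sub : IsSubgroup G H)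
  (𝒟 : Subset G → Set) (cyclic∈𝒟 : ∀ C → IsCyclicSubgroup G C → 𝒟 C)
  {a m : ℕ} (|N|≡pᵃ : card G N ≡ p ℕ.^ a) (n≡pᵃm : FinGroup.n G ≡ p ℕ.^ a ℕ.* m) (p∤m : ¬ p ∣ m) where
  open GroupFacts G
  open Differences G
  open Trace G N H N-sub N-normal H-sub
  open IndexKillsШ² G N N-sub N-normal K N⊆K 𝒟 cyclic∈𝒟 using (Ш²-killed-by-index)

  instance
    q-nonZero : ℕ.NonZero q
    q-nonZero = subst ℕ.NonZero (sym |N|≡pᵃ) (ℕP.m^n≢0 p a {{prime⇒nonZero p-prime}})

  n≡qm : n ≡ q ℕ.* m
  n≡qm = trans n≡pᵃm (cong (ℕ._* m) (sym |N|≡pᵃ))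

  bézout-q : ∀ {M} → ¬ p ∣ M → BézoutIdentity q M
  bézout-q p∤M = subst (λ k → BézoutIdentity k _) (sym |N|≡pᵃ) (bézout-^ p-prime p∤M a)

  p∤* : ∀ {m₁ m₂} → ¬ p ∣ m₁ → ¬ p ∣ m₂ → ¬ p ∣ m₁ ℕ.* m₂
  p∤* {m₁} {m₂} p∤m₁ p∤m₂ p∣m₁m₂ = [ p∤m₁ , p∤m₂ ]′ (euclidsLemma m₁ m₂ p-prime p∣m₁m₂)

  PrimeToPШ² : JH.C² → Set
  PrimeToPШ² c = JH.Ш² 𝒟 c × JH.PrimeToP p c

  -- With u q + v m₁ m₂ = 1: q kills c - c' up to coboundary because inclusion ∘ trace is q,
  -- and m₁ m₂ kills it because m₁ kills c and m₂ kills c'.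
  trace²-injective : ∀ c c' → PrimeToPШ² c → PrimeToPШ² c' → JK.Cohomologous (trace² c) (trace² c') → JH.Cohomologous c c'
  trace²-injective c c' ((c-cocycle , _) , m₁ , p∤m₁ , m₁c-trivial) ((c'-cocycle , _) , m₂ , p∤m₂ , m₂c'-trivial) tc~tc'
    with JK.cohomologous-Δ {trace² c} {trace² c'} tc~tc'
       | JH.isTrivialClass-Δ {m₁ JH.⊛ c} m₁c-trivial
       | JH.isTrivialClass-Δ {m₂ JH.⊛ c'} m₂c'-trivial
  ... | b , tc≡tc'+δb | b₁ , m₁c≡δb₁ | b₂ , m₂c'≡δb₂ =
    JH.bézout-cohomologous {c} {c'} (bézout-q (p∤* p∤m₁ p∤m₂)) B₁ B₂ q-kills m₁m₂-kills
    where
    B₁ B₂ : Fin n → El H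
    B₁ z = inclusion (b z) JH.⊹ (traceCorrection c' z JH.⊹ (JH.⊝ traceCorrection c z))
    B₂ z = scale (+ m₂) (b₁ z) JH.⊹ (JH.⊝ scale (+ m₁) (b₂ z))
    q-kills : ∀ g h x y → + q * (Δ (c g h) x y - Δ (c' g h) x y) ≡ Δδ¹ B₁ g h x y
    q-kills g h x y = trans
      (cancel-traces (+ q) (Δ (c g h) x y) (Δ (c' g h) x y) (Δδ¹ (traceCorrection c) g h x y) (Δδ¹ (traceCorrection c') g h x y)
        (Δ-trace-cocycle c c-cocycle g h x y) (Δ-trace-cocycle c' c'-cocycle g h x y) (tc≡tc'+δb g h x y))
      (sym (trans (JH.Δδ¹-+ (λ z → inclusion (b z)) (λ z → traceCorrection c' z JH.⊹ (JH.⊝ traceCorrection c z)) g h x y) (cong (λ w → Δδ¹ b g h x y + w)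
        (trans (JH.Δδ¹-+ (traceCorrection c') (λ z → JH.⊝ traceCorrection c z) g h x y)
          (cong (λ w → Δδ¹ (traceCorrection c') g h x y + w) (JH.Δδ¹-neg (traceCorrection c) g h x y))))))
      where
      cancel-traces : ∀ t X X' C C' {T T' D} → T ≡ t * X + C → T' ≡ t * X' + C' → T ≡ T' + D → t * (X - X') ≡ D + (C' + - C)
      cancel-traces t X X' C C' {D = D} refl refl eq = begin
        t * (X - X')                                     ≡⟨ regroup t X X' C C' ⟩
        (t * X + C) - (t * X' + C') + (C' + - C)         ≡⟨ cong (λ w → w - (t * X' + C') + (C' + - C)) eq ⟩
        (t * X' + C' + D) - (t * X' + C') + (C' + - C)   ≡⟨ regroup' (t * X' + C') D (C' + - C) ⟩
        D + (C' + - C)                                   ∎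
        where
        open ≡-Reasoning
        regroup : ∀ t X X' C C' → t * (X - X') ≡ (t * X + C) - (t * X' + C') + (C' + - C)
        regroup = solve-∀
        regroup' : ∀ A D E → A + D - A + E ≡ D + E
        regroup' = solve-∀
    m₁m₂-kills : ∀ g h x y → + (m₁ ℕ.* m₂) * (Δ (c g h) x y - Δ (c' g h) x y) ≡ Δδ¹ B₂ g h x y
    m₁m₂-kills g h x y = begin
      + (m₁ ℕ.* m₂) * (X - X')                        ≡⟨ cong (_* (X - X')) (ℤP.pos-* m₁ m₂) ⟩
      + m₁ * + m₂ * (X - X')                          ≡⟨ regroup (+ m₁) (+ m₂) X X' ⟩
      + m₂ * (+ m₁ * X) + - (+ m₁ * (+ m₂ * X'))      ≡⟨ cong₂ (λ s t → + m₂ * s + - (+ m₁ * t)) (m₁X g h x y) (m₂X' g h x y) ⟩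
      + m₂ * Δδ¹ b₁ g h x y + - (+ m₁ * Δδ¹ b₂ g h x y)
        ≡⟨ sym (trans (JH.Δδ¹-+ (λ z → scale (+ m₂) (b₁ z)) (λ z → JH.⊝ scale (+ m₁) (b₂ z)) g h x y) (cong₂ _+_ (Δδ¹-scale (+ m₂) b₁ g h x y)
             (trans (JH.Δδ¹-neg (λ z → scale (+ m₁) (b₂ z)) g h x y) (cong -_ (Δδ¹-scale (+ m₁) b₂ g h x y))))) ⟩
      Δδ¹ B₂ g h x y                                  ∎
      where
      open ≡-Reasoning
      X = Δ (c g h) x y
      X' = Δ (c' g h) x y
      m₁X : ∀ g h x y → + m₁ * Δ (c g h) x y ≡ Δδ¹ b₁ g h x y
      m₁X g h x y = trans (sym (JH.Δ-⊛ m₁ c g h x y)) (m₁c≡δb₁ g h x y)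
      m₂X' : ∀ g h x y → + m₂ * Δ (c' g h) x y ≡ Δδ¹ b₂ g h x y
      m₂X' g h x y = trans (sym (JH.Δ-⊛ m₂ c' g h x y)) (m₂c'≡δb₂ g h x y)
      regroup : ∀ a b X X' → a * b * (X - X') ≡ b * (a * X) + - (a * (b * X'))
      regroup = solve-∀

  -- m kills d, so with u q + v m = 1 the class u d lifts d: its trace is q u d = d - v m d.
  trace²-surjective : ∀ d → JK.Ш² 𝒟 d → Σ JH.C² λ c → PrimeToPШ² c × JK.Cohomologous (trace² c) d
  trace²-surjective d (d-cocycle , d-res) = c , (c∈Ш² , m , p∤m , mc-trivial) , tc~d
    where
    u v : ℤ
    u = proj₁ (bézout-q p∤m)
    v = proj₁ (proj₂ (bézout-q p∤m))
    uq+vm≡1 : u * + q + v * + m ≡ + 1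
    uq+vm≡1 = proj₂ (proj₂ (bézout-q p∤m))
    md-trivial = JK.isTrivialClass-Δ {m JK.⊛ d} (Ш²-killed-by-index m n≡qm d (d-cocycle , d-res))
    Z = proj₁ md-trivial
    md≡δZ : ∀ g h x y → + m * Δ (d g h) x y ≡ Δδ¹ Z g h x y
    md≡δZ g h x y = trans (sym (JK.Δ-⊛ m d g h x y)) (proj₂ md-trivial g h x y)
    c : JH.C²
    c g h = inclusion (scale u (d g h))
    c∈Ш² : JH.Ш² 𝒟 c
    c∈Ш² = JH.Δδ²≡0⇒isCocycle {c} (λ g h k x y → trans (Δδ²-scale u d g h k x y)
             (trans (cong (u *_) (JK.isCocycle⇒Δδ²≡0 {d} d-cocycle g h k x y)) (ℤP.*-zeroʳ u)))
         , λ D D∈𝒟 → let (b , d≡δb) = JK.resVanishes-Δ {d} D (d-res D D∈𝒟) in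
             JH.Δ-resVanishes {c} D (λ z → inclusion (scale u (b z))) λ g h g∈D h∈D x y →
               trans (Δ-scale u (d g h) x y) (trans (cong (u *_) (d≡δb g h g∈D h∈D x y)) (sym (Δδ¹-scale u b g h x y)))
    mc-trivial : JH.IsTrivialClass (m JH.⊛ c)
    mc-trivial = JH.Δ-isTrivialClass {m JH.⊛ c} (λ z → inclusion (scale u (Z z))) λ g h x y → begin
      Δ ((m JH.⊛ c) g h) x y          ≡⟨ JH.Δ-⊛ m c g h x y ⟩
      + m * Δ (c g h) x y             ≡⟨ cong (+ m *_) (Δ-scale u (d g h) x y) ⟩
      + m * (u * Δ (d g h) x y)       ≡⟨ swap (+ m) u (Δ (d g h) x y) ⟩
      u * (+ m * Δ (d g h) x y)       ≡⟨ cong (u *_) (md≡δZ g h x y) ⟩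
      u * Δδ¹ Z g h x y               ≡⟨ sym (Δδ¹-scale u Z g h x y) ⟩
      Δδ¹ (λ z → inclusion (scale u (Z z))) g h x y ∎
      where
      open ≡-Reasoning
      swap : ∀ a b X → a * (b * X) ≡ b * (a * X)
      swap = solve-∀
    tc~d : JK.Cohomologous (trace² c) d
    tc~d = JK.Δ-cohomologous {trace² c} {d} (λ z → scale (- v) (Z z)) λ g h x y → let X = Δ (d g h) x y in begin
      Δ (trace (c g h)) x y           ≡⟨ cong₂ _-_ (trace∘inclusion (scale u (d g h)) x) (trace∘inclusion (scale u (d g h)) y) ⟩
      Δ (scale (+ q) (scale u (d g h))) x y ≡⟨ trans (Δ-scale (+ q) (scale u (d g h)) x y) (cong (+ q *_) (Δ-scale u (d g h) x y)) ⟩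
      + q * (u * X)                   ≡⟨ ℤP.i-j≡0⇒i≡j _ _ (trans (regroup (+ q) u v (+ m) X)
                                           (trans (cong (_* X) (ℤP.i≡j⇒i-j≡0 uq+vm≡1)) (ℤP.*-zeroˡ X))) ⟩
      X + - v * (+ m * X)             ≡⟨ cong (λ w → X + - v * w) (md≡δZ g h x y) ⟩
      X + - v * Δδ¹ Z g h x y         ≡⟨ cong (λ w → X + w) (sym (Δδ¹-scale (- v) Z g h x y)) ⟩
      X + Δδ¹ (λ z → scale (- v) (Z z)) g h x y ∎
      where
      open ≡-Reasoning
      regroup : ∀ q u v m X → q * (u * X) - (X + - v * (m * X)) ≡ (u * q + v * m - + 1) * X
      regroup = solve-∀

  trace²-iso : ClassIso G (J G H) (J G K) PrimeToPШ² (JK.Ш² 𝒟)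
  trace²-iso = trace²
    , (λ c c∈ → trace²-Ш² 𝒟 c (proj₁ c∈))
    , (λ c c' _ _ → trace²-cohomologous c c')
    , (λ c c' _ _ → trace²-⊕ c c')
    , trace²-injective
    , trace²-surjective

theorem4p8 : (G : FinGroup) (p : ℕ) → Prime p → p ∣ FinGroup.n G
    → (Sp : Subset G) → IsSylow G p Sp → IsNormal G Sp → IsAbelianSub G Sp
    → (H : Subset G) → IsSubgroup G H
    → (𝒟 : Subset G → Set) → (∀ D → 𝒟 D → IsSubgroup G D)
    → (∀ C → IsCyclicSubgroup G C → 𝒟 C)
    → (∀ c → (Coh.Ш² G (J G (prodSub G Sp H)) 𝒟 c → Coh.Ш²ω G (J G (prodSub G Sp H)) c)
           × (Coh.Ш²ω G (J G (prodSub G Sp H)) c → Coh.Ш² G (J G (prodSub G Sp H)) 𝒟 c))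
    → ClassIso G (J G H) (J G (prodSub G Sp H))
        (λ c → Coh.Ш² G (J G H) 𝒟 c × Coh.PrimeToP G (J G H) p c)
        (Coh.Ш² G (J G (prodSub G Sp H)) 𝒟)
theorem4p8 G p p-prime _ Sp (Sp-sub , a , m , |Sp|≡pᵃ , n≡pᵃm , p∤m) Sp-normal _ H H-sub 𝒟 _ cyclic∈𝒟 _ =
  PrimeToPIsomorphism.trace²-iso G p-prime Sp Sp-sub Sp-normal H H-sub 𝒟 cyclic∈𝒟 {a} |Sp|≡pᵃ n≡pᵃm p∤m
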